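{- Let $R$ be a principal ideal domain, $n\ge1$, and let $\rho$ be a canonical $R$-quasi-representation of the uniform matroid $U_{n,n}$. Then $H^{0,n}(U_{n,n},\rho)\cong R$ and $H^{i,j}(U_{n,n},\rho)=0$ for all other $(i,j)$.
   Context: $U_{n,n}$ is the matroid on $E=\{1<\dots<n\}$ with rank function $\mathrm{rk}(S)=|S|$. Let $\Bbbk$ be the fraction field of $R$. A canonical $R$-quasi-representation is obtained from a map $\bar\rho:E\to R^m$ all of whose coordinates lie in $\{ -1,0,1\}$ such that $\mathrm{rk}(S)=\dim_\Bbbk\mathrm{span}_\Bbbk\{\bar\rho(e):e\in S\}$ for all $S$, by setting $\rho(S)=\langle\bar\rho(e):e\in S\rangle_R$ and $N=\rho(E)$. $H^{i,j}$ is the cohomology of $C^{i,j}=\bigoplus_{|S|=i}\bigwedge^j_R(N/\rho(S))$ with differential $\sum_{|S|=i}\sum_{f\notin S}\epsilon^{S,f}d^{S,f}$, where $d^{S,f}$ is induced by $N/\rho(S)\to N/\rho(S\cup f)$ and $\epsilon^{S,f}=(-1)^{|\{f'\in S:f'<f\}|}$. -}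

module Defs where

open import Level using (Level; _⊔_) renaming (suc to lsuc)
open import Algebra.Bundles using (CommutativeRing)
open import Data.Nat using (ℕ; zero; suc)
open import Data.Fin using (Fin; _<?_)
open import Data.Fin.Subset using (Subset; ⁅_⁆; _─_; _∩_; ⊤)
  renaming (_∈_ to _∈ₛ_; ∣_∣ to ∣_∣ₛ)
open import Data.Fin.Subset.Properties using (_∈?_)
open import Data.Vec using (Vec; tabulate; _[_]≔_)
open import Data.List using (List; []; _∷_; _++_; map; allFin; concatMap)
open import Data.Product using (Σ; ∃; _×_; _,_)
open import Data.Sum using (_⊎_)
import Data.Bool
open import Relation.Nullary using (¬_; does)
open import Relation.Binary.PropositionalEquality using (_≡_; _≢_)
open import Function.Bundles using (_⇔_)

module _ {c ℓ : Level} (R : CommutativeRing c ℓ) where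

  open CommutativeRing R

  record Ideal : Set (lsuc (c ⊔ ℓ)) where
    field
      mem      : Carrier → Set (c ⊔ ℓ)
      mem-resp : ∀ {x y} → x ≈ y → mem x → mem y
      mem-0    : mem 0#
      mem-+    : ∀ {x y} → mem x → mem y → mem (x + y)
      mem-*    : ∀ r {x} → mem x → mem (r * x)

  IsPrincipal : Ideal → Set (c ⊔ ℓ)
  IsPrincipal I = ∃ λ a → ∀ x → Ideal.mem I x ⇔ (∃ λ r → x ≈ r * a)

  record IsPID : Set (lsuc (c ⊔ ℓ)) where
    field
      nontrivial  : ¬ (1# ≈ 0#)
      noZeroDiv   : ∀ a b → a * b ≈ 0# → a ≈ 0# ⊎ b ≈ 0#
      principal   : ∀ (I : Ideal) → IsPrincipal I

  Σᴿ : ∀ {k} → (Fin k → Carrier) → Carrier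
  Σᴿ {zero}  f = 0#
  Σᴿ {suc k} f = f Fin.zero + Σᴿ (λ i → f (Fin.suc i))

  signPow : ℕ → Carrier
  signPow zero    = 1#
  signPow (suc k) = - signPow k

  -- The fraction field 𝕜 of R, as pairs (numerator , denominator).
  -- Only pairs with nonzero denominator are used as elements of 𝕜;
  -- (a , b) ≈ᴷ (a' , b') iff a * b' ≈ a' * b.

  Frac : Set c
  Frac = Carrier × Carrier

  ValidFrac : Frac → Set ℓ
  ValidFrac (a , b) = ¬ (b ≈ 0#)

  _≈ᴷ_ : Frac → Frac → Set ℓ
  (a , b) ≈ᴷ (a' , b') = a * b' ≈ a' * b

  0ᴷ : Frac
  0ᴷ = (0# , 1#)

  _+ᴷ_ : Frac → Frac → Frac
  (a , b) +ᴷ (a' , b') = (a * b' + a' * b , b * b')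

  _*ᴷ_ : Frac → Frac → Frac
  (a , b) *ᴷ (a' , b') = (a * a' , b * b')

  ι : Carrier → Frac
  ι x = (x , 1#)

  Σᴷ : ∀ {k} → (Fin k → Frac) → Frac
  Σᴷ {zero}  f = 0ᴷ
  Σᴷ {suc k} f = f Fin.zero +ᴷ Σᴷ (λ i → f (Fin.suc i))

  linCombᴷ : ∀ {k m} → (Fin k → Frac) → (Fin k → Fin m → Frac) → Fin m → Frac
  linCombᴷ c w j = Σᴷ (λ t → c t *ᴷ w t j)

  InSpanᴷ : ∀ {k m} → (Fin k → Fin m → Frac) → (Fin m → Frac) → Set (c ⊔ ℓ)
  InSpanᴷ w v = ∃ λ coef → (∀ t → ValidFrac (coef t)) × (∀ j → v j ≈ᴷ linCombᴷ coef w j)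

  InSpanOfSubᴷ : ∀ {k m} → (Fin k → Fin m → Frac) → Subset k → (Fin m → Frac) → Set (c ⊔ ℓ)
  InSpanOfSubᴷ w S v = ∃ λ coef → (∀ t → ValidFrac (coef t))
                                × (∀ t → ¬ (t ∈ₛ S) → coef t ≈ᴷ 0ᴷ)
                                × (∀ j → v j ≈ᴷ linCombᴷ coef w j)

  LinIndepᴷ : ∀ {k m} → (Fin k → Fin m → Frac) → Set (c ⊔ ℓ)
  LinIndepᴷ w = ∀ coef → (∀ t → ValidFrac (coef t))
              → (∀ j → linCombᴷ coef w j ≈ᴷ 0ᴷ) → ∀ t → coef t ≈ᴷ 0ᴷ

  DimSpanᴷ : ∀ {k m} → (Fin k → Fin m → Frac) → Subset k → ℕ → Set (c ⊔ ℓ)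
  DimSpanᴷ {m = m} w S d =
    Σ (Fin d → Fin m → Frac) λ b →
        (∀ t j → ValidFrac (b t j))
      × LinIndepᴷ b
      × (∀ e → e ∈ₛ S → InSpanᴷ b (w e))
      × (∀ t → InSpanOfSubᴷ w S (b t))

  rkU : ∀ {n} → Subset n → ℕ
  rkU S = ∣ S ∣ₛ

  CoordsIn-101 : ∀ {n m} → (Fin n → Fin m → Carrier) → Set ℓ
  CoordsIn-101 ρ̄ = ∀ e j → (ρ̄ e j ≈ - 1#) ⊎ (ρ̄ e j ≈ 0#) ⊎ (ρ̄ e j ≈ 1#)

  IsQuasiRepOfUnn : ∀ {n m} → (Fin n → Fin m → Carrier) → Set (c ⊔ ℓ)
  IsQuasiRepOfUnn ρ̄ = ∀ S → DimSpanᴷ (λ e j → ι (ρ̄ e j)) S (rkU S)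

  module _ {n m : ℕ} (ρ̄ : Fin n → Fin m → Carrier) where

    -- An element of N = ⟨ρ̄ e : e ∈ E⟩_R is presented by a coefficient
    -- vector r, standing for the vector Σ_e r e · ρ̄ e ∈ R^m.
    NElt : Set c
    NElt = Fin n → Carrier

    val : NElt → Fin m → Carrier
    val r j = Σᴿ (λ e → r e * ρ̄ e j)

    _+ᴺ_ : NElt → NElt → NElt
    (r +ᴺ s) e = r e + s e

    _·ᴺ_ : Carrier → NElt → NElt
    (a ·ᴺ r) e = a * r e

    -- equality in N/ρ(S), where ρ(S) = ⟨ρ̄ e : e ∈ S⟩_R:
    -- val x - val y ∈ ρ(S)
    _≈[_]_ : NElt → Subset n → NElt → Set (c ⊔ ℓ)
    x ≈[ S ] y = ∃ λ (s : NElt) → (∀ e → ¬ (e ∈ₛ S) → s e ≈ 0#)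
                    × (∀ j → val x j ≈ val y j + val s j)

    -- Exterior power ⋀^j_R (N/ρ(S)): formal R-linear combinations of
    -- j-tuples of elements, modulo the R-module relations and the
    -- multilinearity/alternating/well-definedness relations.
    Term : ℕ → Set c
    Term j = Carrier × Vec NElt j

    Wedge : ℕ → Set c
    Wedge j = List (Term j)

    _·ᵂ_ : ∀ {j} → Carrier → Wedge j → Wedge j
    a ·ᵂ w = map (λ { (b , v) → (a * b , v) }) w

    data Rel {j : ℕ} (S : Subset n) : Wedge j → Wedge j → Set (c ⊔ ℓ) where
      rel-refl  : ∀ {x} → Rel S x x
      rel-sym   : ∀ {x y} → Rel S x y → Rel S y x
      rel-trans : ∀ {x y z} → Rel S x y → Rel S y z → Rel S x z
      rel-++    : ∀ {x x' y y'} → Rel S x x' → Rel S y y' → Rel S (x ++ y) (x' ++ y')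
      rel-·     : ∀ a {x y} → Rel S x y → Rel S (a ·ᵂ x) (a ·ᵂ y)
      rel-comm  : ∀ x y → Rel S (x ++ y) (y ++ x)
      rel-zero  : ∀ v → Rel S ((0# , v) ∷ []) []
      rel-coef  : ∀ {a b} v → a ≈ b → Rel S ((a , v) ∷ []) ((b , v) ∷ [])
      rel-add   : ∀ a b v → Rel S ((a , v) ∷ (b , v) ∷ []) ((a + b , v) ∷ [])
      rel-entry : ∀ a (v : Vec NElt j) i x y → x ≈[ S ] y
                → Rel S ((a , v [ i ]≔ x) ∷ []) ((a , v [ i ]≔ y) ∷ [])
      rel-lin+  : ∀ a (v : Vec NElt j) i x y
                → Rel S ((a , v [ i ]≔ (x +ᴺ y)) ∷ []) ((a , v [ i ]≔ x) ∷ (a , v [ i ]≔ y) ∷ [])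
      rel-lin·  : ∀ a (v : Vec NElt j) i b x
                → Rel S ((a , v [ i ]≔ (b ·ᴺ x)) ∷ []) ((a * b , v [ i ]≔ x) ∷ [])
      rel-alt   : ∀ a (v : Vec NElt j) i k x → i ≢ k
                → Rel S ((a , (v [ i ]≔ x) [ k ]≔ x) ∷ []) []

    -- C^{i,j} = ⊕_{|S|=i} ⋀^j (N/ρ(S)); a cochain is a function on all
    -- subsets, of which only the values at |S| = i matter.
    Cochain : ℕ → Set c
    Cochain j = Subset n → Wedge j

    _≈C[_]_ : ∀ {j} → Cochain j → ℕ → Cochain j → Set (c ⊔ ℓ)
    x ≈C[ i ] y = ∀ S → ∣ S ∣ₛ ≡ i → Rel S (x S) (y S)

    0C : ∀ {j} → Cochain j
    0C S = []

    _+C_ : ∀ {j} → Cochain j → Cochain j → Cochain j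
    (x +C y) S = x S ++ y S

    _·C_ : ∀ {j} → Carrier → Cochain j → Cochain j
    (a ·C x) S = a ·ᵂ x S

    ε : Subset n → Fin n → Carrier
    ε S f = signPow ∣ S ∩ tabulate (λ f' → does (f' <? f)) ∣ₛ

    -- (d x)(T) = Σ_{f ∈ T} ε^{T∖f,f} d^{T∖f,f}(x(T∖f)); the maps d^{S,f}
    -- are induced by the identity on representatives.
    d : ∀ {j} → Cochain j → Cochain j
    d x T = concatMap (λ f → if does (f ∈? T)
                               then ε (T ─ ⁅ f ⁆) f ·ᵂ x (T ─ ⁅ f ⁆)
                               else [])
                      (allFin n)
      where
      if_then_else_ : ∀ {A : Set c} → _ → A → A → A
      if_then_else_ Data.Bool.true  a b = a
      if_then_else_ Data.Bool.false a b = b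

    IsCocycle : ∀ {j} → ℕ → Cochain j → Set (c ⊔ ℓ)
    IsCocycle i x = d x ≈C[ suc i ] 0C

    HVanishes : ℕ → ℕ → Set (c ⊔ ℓ)
    HVanishes zero    j = ∀ (x : Cochain j) → IsCocycle 0 x → x ≈C[ 0 ] 0C
    HVanishes (suc i) j = ∀ (x : Cochain j) → IsCocycle (suc i) x
                          → ∃ λ (y : Cochain j) → d y ≈C[ suc i ] x

    -- H^{0,j} ≅ R as R-modules (H^{0,j} = Z^{0,j} since C^{-1,j} = 0)
    H0IsoR : ℕ → Set (c ⊔ ℓ)
    H0IsoR j = Σ (Carrier → Cochain j) λ ψ → Σ (Cochain j → Carrier) λ φ →
        (∀ a → IsCocycle 0 (ψ a))
      × (∀ a b → ψ (a + b) ≈C[ 0 ] (ψ a +C ψ b))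
      × (∀ a b → ψ (a * b) ≈C[ 0 ] (a ·C ψ b))
      × (∀ x y → IsCocycle 0 x → IsCocycle 0 y → x ≈C[ 0 ] y → φ x ≈ φ y)
      × (∀ a → φ (ψ a) ≈ a)
      × (∀ x → IsCocycle 0 x → ψ (φ x) ≈C[ 0 ] x)

module Submission where

open import Level using (Level; _⊔_; Lift; lift)
open import Algebra.Bundles using (CommutativeRing)
import Algebra.Properties.CommutativeSemigroup as CommutativeSemigroupProperties
import Algebra.Properties.Ring as RingProperties
import Algebra.Solver.Ring.NaturalCoefficients.Default as NaturalCoefficientsSolver
open import Data.Bool using (Bool; true; false; if_then_else_)
open import Data.Empty using (⊥-elim)
open import Data.Fin as Fin using (Fin; zero; suc; toℕ; punchIn; _<?_)
import Data.Fin.Properties as Finₚ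
open import Data.Fin.Subset using (Subset; ⁅_⁆; _─_; _∩_; ⊤; ⊥)
  renaming (_∈_ to _∈ₛ_; ∣_∣ to ∣_∣ₛ)
open import Data.Fin.Subset.Properties using (_∈?_; p─⊥≡p; ∣⊥∣≡0; ∣⊤∣≡n)
open import Data.List as List using (List; []; _∷_; _++_; map; concatMap)
import Data.List.Properties as Listₚ
open import Data.List.Membership.Propositional using () renaming (_∈_ to _∈ₗ_)
open import Data.List.Membership.Propositional.Properties using (∈-allFin)
open import Data.List.Relation.Unary.Any using (here; there)
open import Data.Nat as ℕ using (ℕ; _<_; _≤_; z≤n; s≤s; pred)
import Data.Nat.Properties as ℕₚ
open import Data.Product using (Σ; ∃; ∃₂; _×_; _,_; proj₁; proj₂)
open import Data.Sum using (_⊎_; inj₁; inj₂)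
open import Data.Vec as Vec using (Vec; []; _∷_; lookup; _[_]≔_; removeAt; insertAt; tabulate)
import Data.Vec.Properties as Vecₚ
open import Function.Base using (_∘_)
open import Function.Bundles using (Equivalence)
open import Relation.Binary using (tri<; tri≈; tri>)
open import Relation.Binary.PropositionalEquality as ≡ using (_≡_; _≢_)
import Relation.Binary.Reasoning.Setoid as SetoidReasoning
open import Relation.Nullary using (¬_; Dec; yes; no; does; ¬?)
open import Relation.Nullary.Decidable using (dec-true; dec-false; decidable-stable; _×-dec_)
open import Defs

-- Over the fraction field 𝕜, the vectors ρ̄ e span a space of dimension rk(E) = n, so they are
-- linearly independent (the case distinctions this needs come from principality, which yields
-- excluded middle). Hence N is free on the ρ̄ e, and N/ρ(S) is free on the e ∉ S.
--
-- Let π e forget the coordinate e. The maps h x = (S ↦ ε^{S,e} ⋀π e (x (S ∪ e)), for e ∉ S) satisfy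
-- δ h + h δ = ⋀π e; composing them over all e yields H with δ H + H δ = 1 - P, where
-- P = ∏ₑ (1 - ⋀π e). On ⋀^j (N/ρ(S)) the projector P vanishes if some e lies in S, and also if
-- j ≠ n, since a wedge of unit vectors of degree j ≠ n misses a coordinate or repeats one. So every
-- cocycle is a coboundary except in bidegree (0, n), where the cocycles form ⋀^n N, which the
-- determinant identifies with R.

module RingFacts {c ℓ : Level} (R : CommutativeRing c ℓ) where
  open CommutativeRing R public hiding (zero)
  open RingProperties ring public
    using (-‿distribˡ-*; -‿distribʳ-*; -1*x≈-x; -‿involutive; -0#≈0#; -‿+-comm; x∙y⁻¹≈ε⇒x≈y; +-inverseˡ-unique)
  open CommutativeSemigroupProperties +-commutativeSemigroup public
    using () renaming (interchange to +-interchange)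
  open SetoidReasoning setoid public

  signPow-square : ∀ k → signPow R k * signPow R k ≈ 1#
  signPow-square ℕ.zero    = *-identityʳ 1#
  signPow-square (ℕ.suc k) = begin
    - signPow R k * - signPow R k     ≈⟨ -‿distribˡ-* _ _ ⟨
    - (signPow R k * - signPow R k)   ≈⟨ -‿cong (-‿distribʳ-* _ _) ⟨
    - - (signPow R k * signPow R k)   ≈⟨ -‿involutive _ ⟩
    signPow R k * signPow R k         ≈⟨ signPow-square k ⟩
    1#                                ∎

  Σᴿ-cong : ∀ {k} {f g : Fin k → Carrier} → (∀ i → f i ≈ g i) → Σᴿ R f ≈ Σᴿ R g
  Σᴿ-cong {ℕ.zero}  p = refl
  Σᴿ-cong {ℕ.suc k} p = +-cong (p zero) (Σᴿ-cong (λ i → p (suc i)))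

  Σᴿ-zero : ∀ {k} {f : Fin k → Carrier} → (∀ i → f i ≈ 0#) → Σᴿ R f ≈ 0#
  Σᴿ-zero {ℕ.zero}  p = refl
  Σᴿ-zero {ℕ.suc k} p = trans (+-cong (p zero) (Σᴿ-zero (λ i → p (suc i)))) (+-identityʳ 0#)

  Σᴿ-+ : ∀ {k} (f g : Fin k → Carrier) → Σᴿ R (λ i → f i + g i) ≈ Σᴿ R f + Σᴿ R g
  Σᴿ-+ {ℕ.zero}  f g = sym (+-identityʳ 0#)
  Σᴿ-+ {ℕ.suc k} f g =
    trans (+-congˡ (Σᴿ-+ (λ i → f (suc i)) (λ i → g (suc i)))) (+-interchange _ _ _ _)

  Σᴿ-*ˡ : ∀ {k} a (f : Fin k → Carrier) → Σᴿ R (λ i → a * f i) ≈ a * Σᴿ R f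
  Σᴿ-*ˡ {ℕ.zero}  a f = sym (zeroʳ a)
  Σᴿ-*ˡ {ℕ.suc k} a f = trans (+-congˡ (Σᴿ-*ˡ a (λ i → f (suc i)))) (sym (distribˡ _ _ _))

  Σᴿ-neg : ∀ {k} (f : Fin k → Carrier) → Σᴿ R (λ i → - f i) ≈ - Σᴿ R f
  Σᴿ-neg {ℕ.zero}  f = sym -0#≈0#
  Σᴿ-neg {ℕ.suc k} f = trans (+-congˡ (Σᴿ-neg (λ i → f (suc i)))) (-‿+-comm _ _)

  Σᴿ-single : ∀ {k} (f : Fin k → Carrier) (e : Fin k) → (∀ i → i ≢ e → f i ≈ 0#) → Σᴿ R f ≈ f e
  Σᴿ-single {ℕ.suc k} f zero p = trans (+-congˡ (Σᴿ-zero (λ i → p (suc i) (λ ())))) (+-identityʳ _)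
  Σᴿ-single {ℕ.suc k} f (suc e) p =
    trans (+-congʳ (p zero (λ ())))
          (trans (+-identityˡ _) (Σᴿ-single (λ i → f (suc i)) e (λ i i≢e → p (suc i) (i≢e ∘ Finₚ.suc-injective))))

  Σᴿ-punchIn : ∀ {k} (f : Fin (ℕ.suc k) → Carrier) i → Σᴿ R f ≈ f i + Σᴿ R (λ l → f (punchIn i l))
  Σᴿ-punchIn f zero = refl
  Σᴿ-punchIn {ℕ.suc k} f (suc i) =
    trans (+-congˡ (Σᴿ-punchIn (λ l → f (suc l)) i))
          (trans (sym (+-assoc _ _ _)) (trans (+-congʳ (+-comm _ _)) (+-assoc _ _ _)))

  unit : ∀ {n} → Fin n → Fin n → Carrier
  unit e f = if does (f Finₚ.≟ e) then 1# else 0#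

  unit-same : ∀ {n} (e : Fin n) → unit e e ≈ 1#
  unit-same e with e Finₚ.≟ e
  ... | yes _   = refl
  ... | no  e≢e = ⊥-elim (e≢e ≡.refl)

  unit-other : ∀ {n} {e f : Fin n} → f ≢ e → unit e f ≈ 0#
  unit-other {e = e} {f} f≢e with f Finₚ.≟ e
  ... | yes f≡e = ⊥-elim (f≢e f≡e)
  ... | no  _   = refl

module SubsetFacts where

  private
    variable
      n : ℕ

  lookup-∈? : ∀ (f : Fin n) (T : Subset n) → does (f ∈? T) ≡ lookup T f
  lookup-∈? zero    (true ∷ T)  = ≡.refl
  lookup-∈? zero    (false ∷ T) = ≡.refl
  lookup-∈? (suc f) (b ∷ T)     = lookup-∈? f T

  lookup≡true⇒∈ : ∀ {f : Fin n} {T} → lookup T f ≡ true → f ∈ₛ T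
  lookup≡true⇒∈ {f = f} {T} = Vecₚ.lookup⇒[]= f T

  ∉⇒lookup≡false : ∀ {f : Fin n} {T} → ¬ (f ∈ₛ T) → lookup T f ≡ false
  ∉⇒lookup≡false {f = f} {T} f∉T with lookup T f in eq
  ... | true  = ⊥-elim (f∉T (lookup≡true⇒∈ eq))
  ... | false = ≡.refl

  lookup≡false⇒∉ : ∀ {f : Fin n} {T} → lookup T f ≡ false → ¬ (f ∈ₛ T)
  lookup≡false⇒∉ eq f∈T with ≡.trans (≡.sym (Vecₚ.[]=⇒lookup f∈T)) eq
  ... | ()

  Subset-ext : ∀ {u v : Subset n} → (∀ i → lookup u i ≡ lookup v i) → u ≡ v
  Subset-ext {u = []}    {[]}    h = ≡.refl
  Subset-ext {u = x ∷ u} {y ∷ v} h = ≡.cong₂ _∷_ (h zero) (Subset-ext (λ i → h (suc i)))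

  insert : Fin n → Subset n → Subset n
  insert e S = S [ e ]≔ true

  lookup-insert : ∀ (e : Fin n) S → lookup (insert e S) e ≡ true
  lookup-insert e S = Vecₚ.lookup∘update e S true

  lookup-insert′ : ∀ {e f : Fin n} S → f ≢ e → lookup (insert e S) f ≡ lookup S f
  lookup-insert′ S f≢e = Vecₚ.lookup∘update′ f≢e S true

  lookup-remove : ∀ (f : Fin n) S → lookup (S ─ ⁅ f ⁆) f ≡ false
  lookup-remove zero    (b ∷ S) = ≡.refl
  lookup-remove (suc f) (b ∷ S) = lookup-remove f S

  lookup-remove′ : ∀ {f g : Fin n} S → g ≢ f → lookup (S ─ ⁅ f ⁆) g ≡ lookup S g
  lookup-remove′ {f = zero}  {zero}  (b ∷ S) g≢f = ⊥-elim (g≢f ≡.refl)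
  lookup-remove′ {f = zero}  {suc g} (b ∷ S) g≢f = ≡.cong (λ U → lookup U g) (p─⊥≡p S)
  lookup-remove′ {f = suc f} {zero}  (b ∷ S) g≢f = ≡.refl
  lookup-remove′ {f = suc f} {suc g} (b ∷ S) g≢f = lookup-remove′ S (g≢f ∘ ≡.cong suc)

  insert-remove : ∀ {e : Fin n} S → lookup S e ≡ true → insert e (S ─ ⁅ e ⁆) ≡ S
  insert-remove {e = e} S e∈S = Subset-ext pointwise
    where
    pointwise : ∀ i → lookup (insert e (S ─ ⁅ e ⁆)) i ≡ lookup S i
    pointwise i with i Finₚ.≟ e
    ... | yes ≡.refl = ≡.trans (lookup-insert e (S ─ ⁅ e ⁆)) (≡.sym e∈S)
    ... | no  i≢e    = ≡.trans (lookup-insert′ (S ─ ⁅ e ⁆) i≢e) (lookup-remove′ S i≢e)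

  remove-insert : ∀ {e : Fin n} S → lookup S e ≡ false → insert e S ─ ⁅ e ⁆ ≡ S
  remove-insert {e = e} S e∉S = Subset-ext pointwise
    where
    pointwise : ∀ i → lookup (insert e S ─ ⁅ e ⁆) i ≡ lookup S i
    pointwise i with i Finₚ.≟ e
    ... | yes ≡.refl = ≡.trans (lookup-remove e (insert e S)) (≡.sym e∉S)
    ... | no  i≢e    = ≡.trans (lookup-remove′ (insert e S) i≢e) (lookup-insert′ S i≢e)

  insert-remove-comm : ∀ {e f : Fin n} S → f ≢ e → insert e (S ─ ⁅ f ⁆) ≡ insert e S ─ ⁅ f ⁆
  insert-remove-comm {e = e} {f} S f≢e = Subset-ext pointwise
    where
    pointwise : ∀ i → lookup (insert e (S ─ ⁅ f ⁆)) i ≡ lookup (insert e S ─ ⁅ f ⁆) i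
    pointwise i with i Finₚ.≟ e | i Finₚ.≟ f
    ... | yes ≡.refl | yes ≡.refl = ⊥-elim (f≢e ≡.refl)
    ... | yes ≡.refl | no  i≢f    =
      ≡.trans (lookup-insert e (S ─ ⁅ f ⁆)) (≡.sym (≡.trans (lookup-remove′ (insert e S) i≢f) (lookup-insert e S)))
    ... | no  i≢e    | yes ≡.refl =
      ≡.trans (lookup-insert′ (S ─ ⁅ f ⁆) i≢e) (≡.trans (lookup-remove f S) (≡.sym (lookup-remove f (insert e S))))
    ... | no  i≢e    | no  i≢f    =
      ≡.trans (lookup-insert′ (S ─ ⁅ f ⁆) i≢e)
              (≡.trans (lookup-remove′ S i≢f) (≡.sym (≡.trans (lookup-remove′ (insert e S) i≢f) (lookup-insert′ S i≢e))))

  sucIf : Bool → ℕ → ℕ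
  sucIf true  k = ℕ.suc k
  sucIf false k = k

  sucIf-suc : ∀ b k → sucIf b (ℕ.suc k) ≡ ℕ.suc (sucIf b k)
  sucIf-suc true  k = ≡.refl
  sucIf-suc false k = ≡.refl

  ∣insert∩∣ : ∀ {g : Fin n} (A B : Subset n) → lookup A g ≡ false
            → ∣ insert g A ∩ B ∣ₛ ≡ sucIf (lookup B g) ∣ A ∩ B ∣ₛ
  ∣insert∩∣ {g = zero}  (false ∷ A) (true ∷ B)  g∉A = ≡.refl
  ∣insert∩∣ {g = zero}  (false ∷ A) (false ∷ B) g∉A = ≡.refl
  ∣insert∩∣ {g = suc g} (true ∷ A)  (true ∷ B)  g∉A =
    ≡.trans (≡.cong ℕ.suc (∣insert∩∣ A B g∉A)) (≡.sym (sucIf-suc (lookup B g) _))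
  ∣insert∩∣ {g = suc g} (true ∷ A)  (false ∷ B) g∉A = ∣insert∩∣ A B g∉A
  ∣insert∩∣ {g = suc g} (false ∷ A) (true ∷ B)  g∉A = ∣insert∩∣ A B g∉A
  ∣insert∩∣ {g = suc g} (false ∷ A) (false ∷ B) g∉A = ∣insert∩∣ A B g∉A

  ∣insert∣ : ∀ {g : Fin n} (A : Subset n) → lookup A g ≡ false → ∣ insert g A ∣ₛ ≡ ℕ.suc ∣ A ∣ₛ
  ∣insert∣ {g = zero}  (false ∷ A) g∉A = ≡.refl
  ∣insert∣ {g = suc g} (true ∷ A)  g∉A = ≡.cong ℕ.suc (∣insert∣ A g∉A)
  ∣insert∣ {g = suc g} (false ∷ A) g∉A = ∣insert∣ A g∉A

  ∣S∣≡0⇒lookup≡false : ∀ (S : Subset n) → ∣ S ∣ₛ ≡ 0 → ∀ f → lookup S f ≡ false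
  ∣S∣≡0⇒lookup≡false (false ∷ S) ∣S∣≡0 zero    = ≡.refl
  ∣S∣≡0⇒lookup≡false (false ∷ S) ∣S∣≡0 (suc f) = ∣S∣≡0⇒lookup≡false S ∣S∣≡0 f
  ∣S∣≡0⇒lookup≡false (true ∷ S)  ()    f

  ∣S∣≡suc⇒nonempty : ∀ (S : Subset n) {k} → ∣ S ∣ₛ ≡ ℕ.suc k → ∃ λ f → lookup S f ≡ true
  ∣S∣≡suc⇒nonempty (true ∷ S)  ∣S∣≡1+k = zero , ≡.refl
  ∣S∣≡suc⇒nonempty (false ∷ S) ∣S∣≡1+k with ∣S∣≡suc⇒nonempty S ∣S∣≡1+k
  ... | f , f∈S = suc f , f∈S

  below : Fin n → Subset n
  below e = tabulate (λ f → does (f <? e))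

  lookup-below : ∀ (e f : Fin n) → lookup (below e) f ≡ does (f <? e)
  lookup-below e f = Vecₚ.lookup∘tabulate (λ f′ → does (f′ <? e)) f

open SubsetFacts

module TupleFacts where

  private
    variable
      n k : ℕ

  Repetition : ∀ {a} {A : Set a} → Vec A k → Set a
  Repetition σ = ∃₂ λ i i′ → i ≢ i′ × lookup σ i ≡ lookup σ i′

  Missing : Vec (Fin n) k → Set
  Missing {n = n} σ = ∃ λ (e : Fin n) → ∀ i → lookup σ i ≢ e

  repetition? : (σ : Vec (Fin n) k) → Dec (Repetition σ)
  repetition? σ = Finₚ.any? λ i → Finₚ.any? λ i′ → ¬? (i Finₚ.≟ i′) ×-dec (lookup σ i Finₚ.≟ lookup σ i′)

  pigeonhole-cover : ∀ {a} {A : Set a} {m} → k < m → (τ : Vec A k) (f : Fin m → A) → (∀ i → ∃ λ p → lookup τ p ≡ f i)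
                   → ∃₂ λ i i′ → i ≢ i′ × f i ≡ f i′
  pigeonhole-cover k<m τ f cover with Finₚ.pigeonhole k<m (proj₁ ∘ cover)
  ... | i , i′ , i<i′ , same-position =
    i , i′ , Finₚ.<⇒≢ i<i′ , ≡.trans (≡.sym (proj₂ (cover i))) (≡.trans (≡.cong (lookup τ) same-position) (proj₂ (cover i′)))

  missing-or-repeated : k ≢ n → (σ : Vec (Fin n) k) → Missing σ ⊎ Repetition σ
  missing-or-repeated {k} {n} k≢n σ with ℕₚ.<-cmp k n
  ... | tri≈ _ k≡n _ = ⊥-elim (k≢n k≡n)
  ... | tri> _ _ n<k with Finₚ.pigeonhole n<k (lookup σ)
  ...   | i , i′ , i<i′ , σi≡σi′ = inj₂ (i , i′ , Finₚ.<⇒≢ i<i′ , σi≡σi′)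
  missing-or-repeated {k} {n} k≢n σ | tri< k<n _ _ with Finₚ.any? (λ e → ¬? (Finₚ.any? (λ i → lookup σ i Finₚ.≟ e)))
  ... | yes (e , e-missed) = inj₁ (e , λ i σi≡e → e-missed (i , σi≡e))
  ... | no none-missed with pigeonhole-cover k<n σ (λ e → e) hit
    where
    hit : ∀ e → ∃ λ i → lookup σ i ≡ e
    hit e = decidable-stable (Finₚ.any? (λ i → lookup σ i Finₚ.≟ e)) (λ e-missed → none-missed (e , e-missed))
  ...   | e , e′ , e≢e′ , e≡e′ = ⊥-elim (e≢e′ e≡e′)

  lookup-removeAt : ∀ {a} {A : Set a} (xs : Vec A (ℕ.suc k)) (l : Fin (ℕ.suc k)) (i : Fin k) → lookup (removeAt xs l) i ≡ lookup xs (punchIn l i)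
  lookup-removeAt (x ∷ xs)     zero    i       = ≡.refl
  lookup-removeAt (x ∷ y ∷ xs) (suc l) zero    = ≡.refl
  lookup-removeAt (x ∷ y ∷ xs) (suc l) (suc i) = lookup-removeAt (y ∷ xs) l i

  map-removeAt : ∀ {a b} {A : Set a} {B : Set b} (f : A → B) (xs : Vec A (ℕ.suc k)) l → removeAt (Vec.map f xs) l ≡ Vec.map f (removeAt xs l)
  map-removeAt f (x ∷ xs)     zero    = ≡.refl
  map-removeAt f (x ∷ y ∷ xs) (suc l) = ≡.cong (f x ∷_) (map-removeAt f (y ∷ xs) l)

open TupleFacts

module PrincipalIdealDomainFacts {c ℓ : Level} (R : CommutativeRing c ℓ) (pid : IsPID R) where
  open RingFacts R
  open IsPID pid

  -- The ideal {x | Q or x ≈ 0} is principal; its generator g lies in it, so either Q holds or g ≈ 0,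
  -- and g ≈ 0 refutes Q because Q would put 1 in the ideal.
  excluded-middle : (Q : Set (c ⊔ ℓ)) → Dec Q
  excluded-middle Q with principal I
    where
    I : Ideal R
    I = record
      { mem      = λ x → Q ⊎ Lift (c ⊔ ℓ) (x ≈ 0#)
      ; mem-resp = λ { x≈y (inj₁ q) → inj₁ q ; x≈y (inj₂ (lift x≈0)) → inj₂ (lift (trans (sym x≈y) x≈0)) }
      ; mem-0    = inj₂ (lift refl)
      ; mem-+    = λ { (inj₁ q) _ → inj₁ q ; _ (inj₁ q) → inj₁ q
                     ; (inj₂ (lift x≈0)) (inj₂ (lift y≈0)) → inj₂ (lift (trans (+-cong x≈0 y≈0) (+-identityʳ 0#))) }
      ; mem-*    = λ { r (inj₁ q) → inj₁ q ; r (inj₂ (lift x≈0)) → inj₂ (lift (trans (*-congˡ x≈0) (zeroʳ r))) }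
      }
  ... | g , generated with Equivalence.from (generated g) (1# , sym (*-identityˡ g))
  ...   | inj₁ q          = yes q
  ...   | inj₂ (lift g≈0) = no λ q → nontrivial (one≈0 q)
    where
    one≈0 : Q → 1# ≈ 0#
    one≈0 q with Equivalence.to (generated 1#) (inj₁ q)
    ... | r , 1≈rg = trans 1≈rg (trans (*-congˡ g≈0) (zeroʳ r))

  _≈?_ : ∀ x y → Dec (x ≈ y)
  x ≈? y with excluded-middle (Lift (c ⊔ ℓ) (x ≈ y))
  ... | yes (lift x≈y) = yes x≈y
  ... | no  x≉y        = no (x≉y ∘ lift)

  *-cancelʳ-nonzero : ∀ {x y d} → ¬ (d ≈ 0#) → x * d ≈ y * d → x ≈ y
  *-cancelʳ-nonzero {x} {y} {d} d≉0 xd≈yd with noZeroDiv (x + - y) d difference≈0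
    where
    difference≈0 : (x + - y) * d ≈ 0#
    difference≈0 = trans (distribʳ d x (- y)) (trans (+-congˡ (sym (-‿distribˡ-* y d))) (trans (+-congʳ xd≈yd) (-‿inverseʳ _)))
  ... | inj₁ x-y≈0 = x∙y⁻¹≈ε⇒x≈y _ _ x-y≈0
  ... | inj₂ d≈0   = ⊥-elim (d≉0 d≈0)

  nonzero-* : ∀ {a b} → ¬ (a ≈ 0#) → ¬ (b ≈ 0#) → ¬ (a * b ≈ 0#)
  nonzero-* a≉0 b≉0 ab≈0 with noZeroDiv _ _ ab≈0
  ... | inj₁ a≈0 = a≉0 a≈0
  ... | inj₂ b≈0 = b≉0 b≈0

module FractionField {c ℓ : Level} (R : CommutativeRing c ℓ) (pid : IsPID R) where
  open RingFacts R
  open IsPID pid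
  open PrincipalIdealDomainFacts R pid
  open NaturalCoefficientsSolver commutativeSemiring using (solve; _:=_; _:+_; _:*_)

  𝕜 : Set (c ⊔ ℓ)
  𝕜 = Σ (Frac R) (ValidFrac R)

  infix  4 _≈𝕜_
  infixl 6 _+𝕜_
  infixl 7 _*𝕜_
  infix  8 -𝕜_

  record _≈𝕜_ (x y : 𝕜) : Set ℓ where
    constructor cross-≈
    field cross : _≈ᴷ_ R (proj₁ x) (proj₁ y)
  open _≈𝕜_ public

  _+𝕜_ : 𝕜 → 𝕜 → 𝕜
  ((a , b) , b≉0) +𝕜 ((a′ , b′) , b′≉0) = _+ᴷ_ R (a , b) (a′ , b′) , nonzero-* b≉0 b′≉0

  _*𝕜_ : 𝕜 → 𝕜 → 𝕜
  ((a , b) , b≉0) *𝕜 ((a′ , b′) , b′≉0) = _*ᴷ_ R (a , b) (a′ , b′) , nonzero-* b≉0 b′≉0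

  -𝕜_ : 𝕜 → 𝕜
  -𝕜 ((a , b) , b≉0) = (- a , b) , b≉0

  0𝕜 1𝕜 : 𝕜
  0𝕜 = (0# , 1#) , nontrivial
  1𝕜 = (1# , 1#) , nontrivial

  ι𝕜 : Carrier → 𝕜
  ι𝕜 x = ι R x , nontrivial

  open CommutativeSemigroupProperties *-commutativeSemigroup using (xy∙z≈xz∙y)

  ≈𝕜-trans : ∀ {x y z} → x ≈𝕜 y → y ≈𝕜 z → x ≈𝕜 z
  ≈𝕜-trans {(a , b) , _} {(a′ , b′) , b′≉0} {(a″ , b″) , _} (cross-≈ ab′≈a′b) (cross-≈ a′b″≈a″b′) =
    cross-≈ (*-cancelʳ-nonzero b′≉0 (begin
      (a * b″) * b′   ≈⟨ xy∙z≈xz∙y a b″ b′ ⟩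
      (a * b′) * b″   ≈⟨ *-congʳ ab′≈a′b ⟩
      (a′ * b) * b″   ≈⟨ xy∙z≈xz∙y a′ b b″ ⟩
      (a′ * b″) * b   ≈⟨ *-congʳ a′b″≈a″b′ ⟩
      (a″ * b′) * b   ≈⟨ xy∙z≈xz∙y a″ b′ b ⟩
      (a″ * b) * b′   ∎))

  +𝕜-cong : ∀ {x x′ y y′} → x ≈𝕜 x′ → y ≈𝕜 y′ → x +𝕜 y ≈𝕜 x′ +𝕜 y′
  +𝕜-cong {(a , b) , _} {(c′ , d) , _} {(e , f) , _} {(g , h) , _} (cross-≈ ad≈c′b) (cross-≈ eh≈gf) = cross-≈ (begin
    (a * f + e * b) * (d * h)                ≈⟨ regroup₁ a f e b d h ⟩
    (a * d) * (f * h) + (e * h) * (b * d)    ≈⟨ +-cong (*-congʳ ad≈c′b) (*-congʳ eh≈gf) ⟩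
    (c′ * b) * (f * h) + (g * f) * (b * d)   ≈⟨ regroup₂ c′ b f h g d ⟩
    (c′ * h + g * d) * (b * f)               ∎)
    where
    regroup₁ : ∀ a f e b d h → (a * f + e * b) * (d * h) ≈ (a * d) * (f * h) + (e * h) * (b * d)
    regroup₁ = solve 6 (λ a f e b d h → ((a :* f) :+ (e :* b)) :* (d :* h) := ((a :* d) :* (f :* h)) :+ ((e :* h) :* (b :* d))) refl
    regroup₂ : ∀ c′ b f h g d → (c′ * b) * (f * h) + (g * f) * (b * d) ≈ (c′ * h + g * d) * (b * f)
    regroup₂ = solve 6 (λ c′ b f h g d → ((c′ :* b) :* (f :* h)) :+ ((g :* f) :* (b :* d)) := ((c′ :* h) :+ (g :* d)) :* (b :* f)) refl

  *𝕜-cong : ∀ {x x′ y y′} → x ≈𝕜 x′ → y ≈𝕜 y′ → x *𝕜 y ≈𝕜 x′ *𝕜 y′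
  *𝕜-cong {(a , b) , _} {(c′ , d) , _} {(e , f) , _} {(g , h) , _} (cross-≈ ad≈c′b) (cross-≈ eh≈gf) = cross-≈ (begin
    (a * e) * (d * h)    ≈⟨ regroup a e d h ⟩
    (a * d) * (e * h)    ≈⟨ *-cong ad≈c′b eh≈gf ⟩
    (c′ * b) * (g * f)   ≈⟨ regroup c′ b g f ⟩
    (c′ * g) * (b * f)   ∎)
    where
    regroup : ∀ a e d h → (a * e) * (d * h) ≈ (a * d) * (e * h)
    regroup = solve 4 (λ a e d h → (a :* e) :* (d :* h) := (a :* d) :* (e :* h)) refl

  𝕜-commutativeRing : CommutativeRing (c ⊔ ℓ) ℓ
  𝕜-commutativeRing = record
    { Carrier = 𝕜 ; _≈_ = _≈𝕜_ ; _+_ = _+𝕜_ ; _*_ = _*𝕜_ ; -_ = -𝕜_ ; 0# = 0𝕜 ; 1# = 1𝕜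
    ; isCommutativeRing = record
      { isRing = record
        { +-isAbelianGroup = record
          { isGroup = record
            { isMonoid = record
              { isSemigroup = record
                { isMagma = record
                  { isEquivalence = record
                    { refl  = cross-≈ refl
                    ; sym   = λ x≈y → cross-≈ (sym (cross x≈y))
                    ; trans = ≈𝕜-trans
                    }
                  ; ∙-cong = +𝕜-cong
                  }
                ; assoc = λ { ((a , b) , _) ((e , f) , _) ((g , h) , _) → cross-≈ (solve 6 (λ a b e f g h →
                    (((a :* f) :+ (e :* b)) :* h :+ g :* (b :* f)) :* (b :* (f :* h))
                      := (a :* (f :* h) :+ ((e :* h) :+ (g :* f)) :* b) :* ((b :* f) :* h)) refl a b e f g h) }
                }
              ; identity = (λ { ((a , b) , _) → cross-≈ (*-cong (trans (+-cong (zeroˡ b) (*-identityʳ a)) (+-identityˡ a)) (sym (*-identityˡ b))) })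
                         , (λ { ((a , b) , _) → cross-≈ (*-cong (trans (+-cong (*-identityʳ a) (zeroˡ b)) (+-identityʳ a)) (sym (*-identityʳ b))) })
              }
            ; inverse = (λ { ((a , b) , _) → cross-≈ (trans (*-identityʳ _)
                                   (trans (+-congʳ (sym (-‿distribˡ-* a b))) (trans (-‿inverseˡ _) (sym (zeroˡ _))))) })
                      , (λ { ((a , b) , _) → cross-≈ (trans (*-identityʳ _)
                                   (trans (+-congˡ (sym (-‿distribˡ-* a b))) (trans (-‿inverseʳ _) (sym (zeroˡ _))))) })
            ; ⁻¹-cong = λ { {(a , b) , _} {(a′ , b′) , _} (cross-≈ ab′≈a′b) →
                            cross-≈ (trans (sym (-‿distribˡ-* a b′)) (trans (-‿cong ab′≈a′b) (-‿distribˡ-* a′ b))) }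
            }
          ; comm = λ { ((a , b) , _) ((e , f) , _) → cross-≈ (solve 4 (λ a b e f →
                       ((a :* f) :+ (e :* b)) :* (f :* b) := ((e :* b) :+ (a :* f)) :* (b :* f)) refl a b e f) }
          }
        ; *-cong = *𝕜-cong
        ; *-assoc = λ { ((a , b) , _) ((e , f) , _) ((g , h) , _) → cross-≈ (solve 6 (λ a b e f g h →
                        ((a :* e) :* g) :* (b :* (f :* h)) := (a :* (e :* g)) :* ((b :* f) :* h)) refl a b e f g h) }
        ; *-identity = (λ { ((a , b) , _) → cross-≈ (*-cong (*-identityˡ a) (sym (*-identityˡ b))) })
                     , (λ { ((a , b) , _) → cross-≈ (*-cong (*-identityʳ a) (sym (*-identityʳ b))) })
        ; distrib = (λ { ((a , b) , _) ((e , f) , _) ((g , h) , _) → cross-≈ (solve 6 (λ a b e f g h →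
                        (a :* ((e :* h) :+ (g :* f))) :* ((b :* f) :* (b :* h))
                          := (((a :* e) :* (b :* h)) :+ ((a :* g) :* (b :* f))) :* (b :* (f :* h))) refl a b e f g h) })
                  , (λ { ((a , b) , _) ((e , f) , _) ((g , h) , _) → cross-≈ (solve 6 (λ a b e f g h →
                        (((e :* h) :+ (g :* f)) :* a) :* ((f :* b) :* (h :* b))
                          := (((e :* a) :* (h :* b)) :+ ((g :* a) :* (f :* b))) :* ((f :* h) :* b)) refl a b e f g h) })
        }
      ; *-comm = λ { ((a , b) , _) ((e , f) , _) → cross-≈ (solve 4 (λ a b e f →
                     (a :* e) :* (f :* b) := (e :* a) :* (b :* f)) refl a b e f) }
      }
    }

  ≈0𝕜⇔numerator≈0 : ∀ x → (x ≈𝕜 0𝕜 → proj₁ (proj₁ x) ≈ 0#) × (proj₁ (proj₁ x) ≈ 0# → x ≈𝕜 0𝕜)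
  ≈0𝕜⇔numerator≈0 ((a , b) , _) =
    (λ (cross-≈ a1≈0b) → trans (sym (*-identityʳ a)) (trans a1≈0b (zeroˡ b))) ,
    (λ a≈0 → cross-≈ (trans (*-identityʳ a) (trans a≈0 (sym (zeroˡ b)))))

  1𝕜≉0𝕜 : ¬ (1𝕜 ≈𝕜 0𝕜)
  1𝕜≉0𝕜 1≈0 = nontrivial (proj₁ (≈0𝕜⇔numerator≈0 1𝕜) 1≈0)

  _≈0𝕜? : ∀ x → Dec (x ≈𝕜 0𝕜)
  x ≈0𝕜? with proj₁ (proj₁ x) ≈? 0#
  ... | yes a≈0 = yes (proj₂ (≈0𝕜⇔numerator≈0 x) a≈0)
  ... | no  a≉0 = no (a≉0 ∘ proj₁ (≈0𝕜⇔numerator≈0 x))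

  𝕜-inverse : ∀ x → ¬ (x ≈𝕜 0𝕜) → ∃ λ y → x *𝕜 y ≈𝕜 1𝕜
  𝕜-inverse x@((a , b) , _) x≉0 =
    ((b , a) , x≉0 ∘ proj₂ (≈0𝕜⇔numerator≈0 x)) , cross-≈ (trans (*-identityʳ _) (trans (*-comm a b) (sym (*-identityˡ _))))

  ι𝕜-nonzero : ∀ x → ¬ (x ≈ 0#) → ¬ (ι𝕜 x ≈𝕜 0𝕜)
  ι𝕜-nonzero x x≉0 = x≉0 ∘ proj₁ (≈0𝕜⇔numerator≈0 (ι𝕜 x))

module FieldLinearAlgebra {c ℓ : Level} (F : CommutativeRing c ℓ) where
  open RingFacts F

  Σᴿ-swap : ∀ {k l} (A : Fin k → Fin l → Carrier) → Σᴿ F (λ i → Σᴿ F (A i)) ≈ Σᴿ F (λ t → Σᴿ F (λ i → A i t))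
  Σᴿ-swap {ℕ.zero} {l} A = sym (Σᴿ-zero {l} (λ _ → refl))
  Σᴿ-swap {ℕ.suc k} A = trans (+-congˡ (Σᴿ-swap (λ i → A (suc i)))) (sym (Σᴿ-+ (A zero) (λ t → Σᴿ F (λ i → A (suc i) t))))

  subtractMultiples : ∀ {K k} (A : Fin (ℕ.suc K) → Fin k → Carrier) (i₀ : Fin (ℕ.suc K)) (λ′ : Fin K → Carrier)
                    → Fin K → Fin k → Carrier
  subtractMultiples A i₀ λ′ l t = A (punchIn i₀ l) t + - (λ′ l * A i₀ t)

  -- Off i₀ this is s; at i₀ it is - Σ s l λ′ l, which cancels the multiples λ′ l of row i₀ that were
  -- subtracted from the other rows.
  withPivot : ∀ {K} (i₀ : Fin (ℕ.suc K)) (s λ′ : Fin K → Carrier) → Fin (ℕ.suc K) → Carrier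
  withPivot i₀ s λ′ = lookup (insertAt (tabulate s) i₀ (- Σᴿ F (λ l → s l * λ′ l)))

  withPivot-punchIn : ∀ {K} i₀ (s λ′ : Fin K → Carrier) l → withPivot i₀ s λ′ (punchIn i₀ l) ≡ s l
  withPivot-punchIn i₀ s λ′ l = ≡.trans (Vecₚ.insertAt-punchIn (tabulate s) i₀ _ l) (Vecₚ.lookup∘tabulate s l)

  withPivot-combination : ∀ {K k} (A : Fin (ℕ.suc K) → Fin k → Carrier) i₀ (s λ′ : Fin K → Carrier) t
                        → Σᴿ F (λ l → s l * subtractMultiples A i₀ λ′ l t) ≈ 0#
                        → Σᴿ F (λ i → withPivot i₀ s λ′ i * A i t) ≈ 0#
  withPivot-combination {K} A i₀ s λ′ t reduced≈0 = begin
    Σᴿ F (λ i → withPivot i₀ s λ′ i * A i t)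
      ≈⟨ Σᴿ-punchIn (λ i → withPivot i₀ s λ′ i * A i t) i₀ ⟩
    withPivot i₀ s λ′ i₀ * A i₀ t + Σᴿ F (λ l → withPivot i₀ s λ′ (punchIn i₀ l) * A (punchIn i₀ l) t)
      ≈⟨ +-cong (*-congʳ (reflexive (Vecₚ.insertAt-lookup (tabulate s) i₀ _)))
                (Σᴿ-cong (λ l → *-cong (reflexive (withPivot-punchIn i₀ s λ′ l)) (split l))) ⟩
    - Σλ * A i₀ t + Σᴿ F (λ l → s l * (subtractMultiples A i₀ λ′ l t + λ′ l * A i₀ t))
      ≈⟨ +-congˡ (trans (Σᴿ-cong (λ l → distribˡ (s l) _ _)) (Σᴿ-+ (λ l → s l * subtractMultiples A i₀ λ′ l t) _)) ⟩
    - Σλ * A i₀ t + (Σᴿ F (λ l → s l * subtractMultiples A i₀ λ′ l t) + Σᴿ F (λ l → s l * (λ′ l * A i₀ t)))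
      ≈⟨ +-congˡ (+-cong reduced≈0 pull-out) ⟩
    - Σλ * A i₀ t + (0# + Σλ * A i₀ t)                             ≈⟨ +-congˡ (+-identityˡ _) ⟩
    - Σλ * A i₀ t + Σλ * A i₀ t                                    ≈⟨ +-congʳ (-‿distribˡ-* _ _) ⟨
    - (Σλ * A i₀ t) + Σλ * A i₀ t                                  ≈⟨ -‿inverseˡ _ ⟩
    0#                                                             ∎
    where
    Σλ : Carrier
    Σλ = Σᴿ F (λ l → s l * λ′ l)

    split : ∀ l → A (punchIn i₀ l) t ≈ subtractMultiples A i₀ λ′ l t + λ′ l * A i₀ t
    split l = sym (trans (+-assoc _ _ _) (trans (+-congˡ (-‿inverseˡ _)) (+-identityʳ _)))

    pull-out : Σᴿ F (λ l → s l * (λ′ l * A i₀ t)) ≈ Σλ * A i₀ t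
    pull-out = trans (Σᴿ-cong (λ (l : Fin K) → trans (sym (*-assoc _ _ _)) (*-comm _ _)))
                     (trans (Σᴿ-*ˡ (A i₀ t) (λ l → s l * λ′ l)) (*-comm _ _))

  combination-of-combinations : ∀ {K k m} (r : Fin K → Carrier) (A : Fin K → Fin k → Carrier) (u : Fin k → Fin m → Carrier)
                                (w : Fin K → Fin m → Carrier) → (∀ i j → w i j ≈ Σᴿ F (λ t → A i t * u t j))
                              → ∀ j → Σᴿ F (λ i → r i * w i j) ≈ Σᴿ F (λ t → u t j * Σᴿ F (λ i → r i * A i t))
  combination-of-combinations {K} r A u w w≈Au j = begin
    Σᴿ F (λ i → r i * w i j)                        ≈⟨ Σᴿ-cong (λ i → *-congˡ (w≈Au i j)) ⟩
    Σᴿ F (λ i → r i * Σᴿ F (λ t → A i t * u t j))   ≈⟨ Σᴿ-cong (λ i → sym (Σᴿ-*ˡ (r i) (λ t → A i t * u t j))) ⟩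
    Σᴿ F (λ i → Σᴿ F (λ t → r i * (A i t * u t j))) ≈⟨ Σᴿ-swap (λ i t → r i * (A i t * u t j)) ⟩
    Σᴿ F (λ t → Σᴿ F (λ i → r i * (A i t * u t j)))
      ≈⟨ Σᴿ-cong (λ t → trans (Σᴿ-cong (λ (i : Fin K) → trans (sym (*-assoc _ _ _)) (*-comm _ _))) (Σᴿ-*ˡ (u t j) (λ i → r i * A i t))) ⟩
    Σᴿ F (λ t → u t j * Σᴿ F (λ i → r i * A i t))   ∎

  -- Substitutes v e₀ = - r₀⁻¹ Σₗ r (punchIn e₀ l) v (punchIn e₀ l), which is what the relation r says.
  eliminate-vector : ∀ {k m} (v : Fin (ℕ.suc k) → Fin m → Carrier) (r : Fin (ℕ.suc k) → Carrier) e₀ r₀⁻¹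
                   → r e₀ * r₀⁻¹ ≈ 1# → (∀ j → Σᴿ F (λ e → r e * v e j) ≈ 0#)
                   → ∀ (a : Fin (ℕ.suc k) → Carrier) j
                   → Σᴿ F (λ e → a e * v e j)
                     ≈ Σᴿ F (λ l → (a (punchIn e₀ l) + - (a e₀ * (r (punchIn e₀ l) * r₀⁻¹))) * v (punchIn e₀ l) j)
  eliminate-vector {k} v r e₀ r₀⁻¹ r₀r₀⁻¹≈1 relation a j = begin
    Σᴿ F (λ e → a e * v e j)                                       ≈⟨ Σᴿ-punchIn (λ e → a e * v e j) e₀ ⟩
    a e₀ * v e₀ j + Σᴿ F (λ l → a (pI l) * v (pI l) j)             ≈⟨ +-comm _ _ ⟩
    Σᴿ F (λ l → a (pI l) * v (pI l) j) + a e₀ * v e₀ j             ≈⟨ +-congˡ eliminated ⟩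
    Σᴿ F (λ l → a (pI l) * v (pI l) j) + Σᴿ F (λ l → - (a e₀ * (r (pI l) * r₀⁻¹)) * v (pI l) j) ≈⟨ Σᴿ-+ {k} _ _ ⟨
    Σᴿ F (λ l → a (pI l) * v (pI l) j + - (a e₀ * (r (pI l) * r₀⁻¹)) * v (pI l) j) ≈⟨ Σᴿ-cong {k} (λ l → distribʳ _ _ _) ⟨
    Σᴿ F (λ l → (a (pI l) + - (a e₀ * (r (pI l) * r₀⁻¹))) * v (pI l) j) ∎
    where
    pI : Fin k → Fin (ℕ.suc k)
    pI = punchIn e₀
    open NaturalCoefficientsSolver commutativeSemiring using (solve; _:=_; _:*_)

    r₀v₀ : r e₀ * v e₀ j ≈ - Σᴿ F (λ l → r (pI l) * v (pI l) j)
    r₀v₀ = +-inverseˡ-unique _ _ (trans (sym (Σᴿ-punchIn (λ e → r e * v e j) e₀)) (relation j))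

    rearrange : ∀ x y z w → - ((x * y) * (z * w)) ≈ - (x * (z * y)) * w
    rearrange x y z w =
      trans (-‿cong (solve 4 (λ x y z w → (x :* y) :* (z :* w) := (x :* (z :* y)) :* w) refl x y z w)) (-‿distribˡ-* _ _)

    eliminated : a e₀ * v e₀ j ≈ Σᴿ F (λ l → - (a e₀ * (r (pI l) * r₀⁻¹)) * v (pI l) j)
    eliminated = begin
      a e₀ * v e₀ j                                         ≈⟨ *-congˡ (trans (sym (*-identityˡ _)) (*-congʳ (trans (sym r₀r₀⁻¹≈1) (*-comm _ _)))) ⟩
      a e₀ * ((r₀⁻¹ * r e₀) * v e₀ j)                       ≈⟨ trans (*-congˡ (*-assoc _ _ _)) (sym (*-assoc _ _ _)) ⟩
      (a e₀ * r₀⁻¹) * (r e₀ * v e₀ j)                       ≈⟨ *-congˡ r₀v₀ ⟩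
      (a e₀ * r₀⁻¹) * - Σᴿ F (λ l → r (pI l) * v (pI l) j)  ≈⟨ -‿distribʳ-* _ _ ⟨
      - ((a e₀ * r₀⁻¹) * Σᴿ F (λ l → r (pI l) * v (pI l) j)) ≈⟨ -‿cong (Σᴿ-*ˡ {k} _ _) ⟨
      - Σᴿ F (λ l → (a e₀ * r₀⁻¹) * (r (pI l) * v (pI l) j)) ≈⟨ Σᴿ-neg {k} _ ⟨
      Σᴿ F (λ l → - ((a e₀ * r₀⁻¹) * (r (pI l) * v (pI l) j))) ≈⟨ Σᴿ-cong {k} (λ l → rearrange _ _ _ _) ⟩
      Σᴿ F (λ l → - (a e₀ * (r (pI l) * r₀⁻¹)) * v (pI l) j) ∎

  NontrivialRelation : ∀ {K k} → (Fin K → Fin k → Carrier) → Set (c ⊔ ℓ)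
  NontrivialRelation {K} A = ∃ λ (r : Fin K → Carrier) → (∃ λ i → ¬ (r i ≈ 0#)) × (∀ t → Σᴿ F (λ i → r i * A i t) ≈ 0#)

  module _ (1≉0 : ¬ (1# ≈ 0#)) (inverse : ∀ x → ¬ (x ≈ 0#) → ∃ λ y → x * y ≈ 1#) (_≈0? : ∀ x → Dec (x ≈ 0#)) where

    -- Gaussian elimination: either the first column vanishes, or a pivot clears it from the other rows.
    more-rows-than-columns : ∀ k (A : Fin (ℕ.suc k) → Fin k → Carrier) → NontrivialRelation A
    more-rows-than-columns ℕ.zero    A = (λ _ → 1#) , (zero , 1≉0) , λ ()
    more-rows-than-columns (ℕ.suc k) A with Finₚ.any? (λ i → ¬? (A i zero ≈0?))
    more-rows-than-columns (ℕ.suc k) A | no zero-column with more-rows-than-columns k (λ i t → A (suc i) (suc t))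
    ... | s , (i₁ , s≉0) , s-relation = r , (suc i₁ , s≉0) , λ t → trans (+-congʳ (zeroˡ _)) (trans (+-identityˡ _) (rest-relation t))
      where
      r : Fin (ℕ.suc (ℕ.suc k)) → Carrier
      r zero    = 0#
      r (suc i) = s i

      rest-relation : ∀ t → Σᴿ F (λ i → s i * A (suc i) t) ≈ 0#
      rest-relation zero    = Σᴿ-zero {f = λ i → s i * A (suc i) zero} λ i →
        trans (*-congˡ (decidable-stable (A (suc i) zero ≈0?) (λ Aᵢ≉0 → zero-column (suc i , Aᵢ≉0)))) (zeroʳ _)
      rest-relation (suc t) = s-relation t
    more-rows-than-columns (ℕ.suc k) A | yes (i₀ , pivot≉0) with inverse (A i₀ zero) pivot≉0
    ... | pivot⁻¹ , pivot*pivot⁻¹≈1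
      with more-rows-than-columns k (λ l t → subtractMultiples A i₀ (λ l′ → A (punchIn i₀ l′) zero * pivot⁻¹) l (suc t))
    ...   | s , (l₁ , s≉0) , s-relation =
      withPivot i₀ s λ′ , (punchIn i₀ l₁ , λ r≈0 → s≉0 (trans (sym (reflexive (withPivot-punchIn i₀ s λ′ l₁))) r≈0)) ,
      λ t → withPivot-combination A i₀ s λ′ t (reduced-relation t)
      where
      λ′ : Fin (ℕ.suc k) → Carrier
      λ′ l = A (punchIn i₀ l) zero * pivot⁻¹

      first-column-cleared : ∀ l → subtractMultiples A i₀ λ′ l zero ≈ 0#
      first-column-cleared l = trans (+-congˡ (-‿cong λ′pivot≈)) (-‿inverseʳ _)
        where
        λ′pivot≈ : λ′ l * A i₀ zero ≈ A (punchIn i₀ l) zero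
        λ′pivot≈ = trans (*-assoc _ _ _) (trans (*-congˡ (trans (*-comm _ _) pivot*pivot⁻¹≈1)) (*-identityʳ _))

      reduced-relation : ∀ t → Σᴿ F (λ l → s l * subtractMultiples A i₀ λ′ l t) ≈ 0#
      reduced-relation zero    = Σᴿ-zero {f = λ l → s l * subtractMultiples A i₀ λ′ l zero} λ l →
        trans (*-congˡ (first-column-cleared l)) (zeroʳ _)
      reduced-relation (suc t) = s-relation t

    fewer-spanning⇒dependent : ∀ k {m} (u : Fin k → Fin m → Carrier) (w : Fin (ℕ.suc k) → Fin m → Carrier)
                               (A : Fin (ℕ.suc k) → Fin k → Carrier)
                             → (∀ i j → w i j ≈ Σᴿ F (λ t → A i t * u t j)) → NontrivialRelation w
    fewer-spanning⇒dependent k u w A w≈Au with more-rows-than-columns k A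
    ... | r , nonzero , rA≈0 = r , nonzero , λ j →
      trans (combination-of-combinations r A u w w≈Au j) (Σᴿ-zero (λ t → trans (*-congˡ (rA≈0 t)) (zeroʳ _)))

LinearlyIndependent : ∀ {c ℓ} (R : CommutativeRing c ℓ) {n m} → (Fin n → Fin m → CommutativeRing.Carrier R) → Set (c ⊔ ℓ)
LinearlyIndependent R ρ̄ = ∀ r → (∀ j → val R ρ̄ r j ≈ 0#) → ∀ e → r e ≈ 0#
  where open CommutativeRing R

module QuasiRepresentationIndependence {c ℓ : Level} (R : CommutativeRing c ℓ) (pid : IsPID R) where
  open RingFacts R
  open PrincipalIdealDomainFacts R pid using (_≈?_)
  open FractionField R pid
  module 𝕜 = RingFacts 𝕜-commutativeRing
  open FieldLinearAlgebra 𝕜-commutativeRing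

  numerator-Σᴿ : ∀ {k} (f : Fin k → 𝕜) → proj₁ (Σᴿ 𝕜-commutativeRing f) ≡ Σᴷ R (λ i → proj₁ (f i))
  numerator-Σᴿ {ℕ.zero}  f = ≡.refl
  numerator-Σᴿ {ℕ.suc k} f = ≡.cong (_+ᴷ_ R (proj₁ (f zero))) (numerator-Σᴿ (λ i → f (suc i)))

  ι𝕜-+ : ∀ a b → ι𝕜 (a + b) ≈𝕜 ι𝕜 a +𝕜 ι𝕜 b
  ι𝕜-+ a b = cross-≈ (trans (*-congˡ (*-identityʳ 1#))
                             (trans (*-identityʳ _) (sym (trans (*-identityʳ _) (+-cong (*-identityʳ a) (*-identityʳ b))))))

  ι𝕜-* : ∀ a b → ι𝕜 (a * b) ≈𝕜 ι𝕜 a *𝕜 ι𝕜 b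
  ι𝕜-* a b = cross-≈ (*-congˡ (*-identityʳ 1#))

  ι𝕜-Σᴿ : ∀ {k} (f : Fin k → Carrier) → Σᴿ 𝕜-commutativeRing (λ i → ι𝕜 (f i)) ≈𝕜 ι𝕜 (Σᴿ R f)
  ι𝕜-Σᴿ {ℕ.zero}  f = 𝕜.refl
  ι𝕜-Σᴿ {ℕ.suc k} f =
    𝕜.trans (𝕜.+-congˡ {ι𝕜 (f zero)} (ι𝕜-Σᴿ (λ i → f (suc i)))) (𝕜.sym (ι𝕜-+ (f zero) (Σᴿ R (λ i → f (suc i)))))

  -- A 𝕜-basis of the span of all the ρ̄ e has n elements, while a nontrivial R-relation among the
  -- ρ̄ e puts that span inside the span of n - 1 of them.
  quasiRep⇒independent : ∀ {n m} (ρ̄ : Fin n → Fin m → Carrier) → IsQuasiRepOfUnn R ρ̄ → LinearlyIndependent R ρ̄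
  quasiRep⇒independent {ℕ.zero}      ρ̄ quasiRep r relation ()
  quasiRep⇒independent {ℕ.suc n′} {m} ρ̄ quasiRep r relation e₀ with r e₀ ≈? 0#
  ... | yes r₀≈0 = r₀≈0
  ... | no  r₀≉0 = ⊥-elim (refute (≡.subst (DimSpanᴷ R (λ e j → ι R (ρ̄ e j)) ⊤) (∣⊤∣≡n (ℕ.suc n′)) (quasiRep ⊤))
                                  (𝕜-inverse (ι𝕜 (r e₀)) (ι𝕜-nonzero (r e₀) r₀≉0)))
    where
    ρ𝕜 : Fin (ℕ.suc n′) → Fin m → 𝕜
    ρ𝕜 e j = ι𝕜 (ρ̄ e j)

    r𝕜 : Fin (ℕ.suc n′) → 𝕜
    r𝕜 e = ι𝕜 (r e)

    relation𝕜 : ∀ j → Σᴿ 𝕜-commutativeRing (λ e → r𝕜 e *𝕜 ρ𝕜 e j) ≈𝕜 0𝕜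
    relation𝕜 j = 𝕜.trans (𝕜.Σᴿ-cong (λ e → 𝕜.sym (ι𝕜-* (r e) (ρ̄ e j))))
                          (𝕜.trans (ι𝕜-Σᴿ (λ e → r e * ρ̄ e j)) (cross-≈ (*-congʳ (relation j))))

    refute : DimSpanᴷ R (λ e j → ι R (ρ̄ e j)) ⊤ (ℕ.suc n′) → ¬ (∃ λ y → r𝕜 e₀ *𝕜 y ≈𝕜 1𝕜)
    refute (b , b-valid , b-independent , _ , b-in-span) (r₀⁻¹ , r₀r₀⁻¹≈1) =
      independent-b (fewer-spanning⇒dependent 1𝕜≉0𝕜 𝕜-inverse _≈0𝕜? n′ (λ l → ρ𝕜 (punchIn e₀ l)) b𝕜 A b-in-smaller-span)
      where
      b𝕜 : Fin (ℕ.suc n′) → Fin m → 𝕜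
      b𝕜 t j = b t j , b-valid t j

      coefficient : Fin (ℕ.suc n′) → Fin (ℕ.suc n′) → 𝕜
      coefficient t e = proj₁ (b-in-span t) e , proj₁ (proj₂ (b-in-span t)) e

      b-combination : ∀ t j → b𝕜 t j ≈𝕜 Σᴿ 𝕜-commutativeRing (λ e → coefficient t e *𝕜 ρ𝕜 e j)
      b-combination t j = cross-≈ (≡.subst (_≈ᴷ_ R (b t j)) (≡.sym (numerator-Σᴿ (λ e → coefficient t e *𝕜 ρ𝕜 e j)))
                                           (proj₂ (proj₂ (proj₂ (b-in-span t))) j))

      A : Fin (ℕ.suc n′) → Fin n′ → 𝕜
      A t l = coefficient t (punchIn e₀ l) +𝕜 -𝕜 (coefficient t e₀ *𝕜 (r𝕜 (punchIn e₀ l) *𝕜 r₀⁻¹))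

      b-in-smaller-span : ∀ t j → b𝕜 t j ≈𝕜 Σᴿ 𝕜-commutativeRing (λ l → A t l *𝕜 ρ𝕜 (punchIn e₀ l) j)
      b-in-smaller-span t j =
        𝕜.trans (b-combination t j) (eliminate-vector ρ𝕜 r𝕜 e₀ r₀⁻¹ r₀r₀⁻¹≈1 relation𝕜 (coefficient t) j)

      independent-b : ¬ NontrivialRelation b𝕜
      independent-b (s , (t₀ , s₀≉0) , s-relation) = s₀≉0 (cross-≈ (b-independent (proj₁ ∘ s) (proj₂ ∘ s) s-relationᴷ t₀))
        where
        s-relationᴷ : ∀ j → _≈ᴷ_ R (linCombᴷ R (proj₁ ∘ s) b j) (0ᴷ R)
        s-relationᴷ j = ≡.subst (λ z → _≈ᴷ_ R z (0ᴷ R)) (numerator-Σᴿ (λ t → s t *𝕜 b𝕜 t j)) (cross (s-relation j))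

module ExteriorCalculus {c ℓ : Level} (R : CommutativeRing c ℓ) {n m : ℕ} (ρ̄ : Fin n → Fin m → CommutativeRing.Carrier R) where
  open RingFacts R

  Nᶜ : Set c
  Nᶜ = Fin n → Carrier

  ⋀ : ℕ → Set c
  ⋀ j = Wedge R ρ̄ j

  infix  4 _≈ᵂ[_]_ _≈ᴺ[_]_ _≈ᴺ_
  infixr 2 _▸_

  _≈ᵂ[_]_ : ∀ {j} → ⋀ j → Subset n → ⋀ j → Set (c ⊔ ℓ)
  x ≈ᵂ[ S ] y = Rel R ρ̄ S x y

  _≈ᴺ[_]_ : Nᶜ → Subset n → Nᶜ → Set (c ⊔ ℓ)
  x ≈ᴺ[ S ] y = _≈[_]_ R ρ̄ x S y

  _≈ᴺ_ : Nᶜ → Nᶜ → Set ℓ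
  x ≈ᴺ y = ∀ e → x e ≈ y e

  0ᴺ : Nᶜ
  0ᴺ _ = 0#

  _+ₙ_ : Nᶜ → Nᶜ → Nᶜ
  _+ₙ_ = _+ᴺ_ R ρ̄

  _·ₙ_ : Carrier → Nᶜ → Nᶜ
  _·ₙ_ = _·ᴺ_ R ρ̄

  value : Nᶜ → Fin m → Carrier
  value = val R ρ̄

  scale : ∀ {j} → Carrier → ⋀ j → ⋀ j
  scale = _·ᵂ_ R ρ̄

  negate : ∀ {j} → ⋀ j → ⋀ j
  negate = scale (- 1#)

  _▸_ : ∀ {j S} {x y z : ⋀ j} → x ≈ᵂ[ S ] y → y ≈ᵂ[ S ] z → x ≈ᵂ[ S ] z
  _▸_ = rel-trans

  ≡⇒≈ᵂ : ∀ {j S} {x y : ⋀ j} → x ≡ y → x ≈ᵂ[ S ] y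
  ≡⇒≈ᵂ ≡.refl = rel-refl

  ++-congʳ : ∀ {j S} {x x′ : ⋀ j} (y : ⋀ j) → x ≈ᵂ[ S ] x′ → x ++ y ≈ᵂ[ S ] x′ ++ y
  ++-congʳ y x≈x′ = rel-++ x≈x′ rel-refl

  ++-congˡ : ∀ {j S} (x : ⋀ j) {y y′ : ⋀ j} → y ≈ᵂ[ S ] y′ → x ++ y ≈ᵂ[ S ] x ++ y′
  ++-congˡ x y≈y′ = rel-++ rel-refl y≈y′

  ++-assoc : ∀ {j S} (x y z : ⋀ j) → (x ++ y) ++ z ≈ᵂ[ S ] x ++ (y ++ z)
  ++-assoc x y z = ≡⇒≈ᵂ (Listₚ.++-assoc x y z)

  ++-identityʳ : ∀ {j S} (x : ⋀ j) → x ++ [] ≈ᵂ[ S ] x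
  ++-identityʳ x = ≡⇒≈ᵂ (Listₚ.++-identityʳ x)

  ++-interchange : ∀ {j S} (w x y z : ⋀ j) → (w ++ x) ++ (y ++ z) ≈ᵂ[ S ] (w ++ y) ++ (x ++ z)
  ++-interchange w x y z =
    ++-assoc w x (y ++ z)
    ▸ ++-congˡ w (rel-sym (++-assoc x y z) ▸ ++-congʳ z (rel-comm x y) ▸ ++-assoc y x z)
    ▸ rel-sym (++-assoc w y (x ++ z))

  scale-++ : ∀ {j} a (x y : ⋀ j) → scale a (x ++ y) ≡ scale a x ++ scale a y
  scale-++ a []      y = ≡.refl
  scale-++ a (t ∷ x) y = ≡.cong (_ ∷_) (scale-++ a x y)

  scale-scale : ∀ {j S} a b (w : ⋀ j) → scale a (scale b w) ≈ᵂ[ S ] scale (a * b) w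
  scale-scale a b []            = rel-refl
  scale-scale a b ((t , v) ∷ w) = rel-++ (rel-coef v (sym (*-assoc a b t))) (scale-scale a b w)

  scale-cong : ∀ {j S} {a b} (w : ⋀ j) → a ≈ b → scale a w ≈ᵂ[ S ] scale b w
  scale-cong []            a≈b = rel-refl
  scale-cong ((t , v) ∷ w) a≈b = rel-++ (rel-coef v (*-congʳ a≈b)) (scale-cong w a≈b)

  scale-1 : ∀ {j S} (w : ⋀ j) → scale 1# w ≈ᵂ[ S ] w
  scale-1 []            = rel-refl
  scale-1 ((t , v) ∷ w) = rel-++ (rel-coef v (*-identityˡ t)) (scale-1 w)

  scale-+ : ∀ {j S} a b (w : ⋀ j) → scale a w ++ scale b w ≈ᵂ[ S ] scale (a + b) w
  scale-+ a b []            = rel-refl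
  scale-+ a b ((t , v) ∷ w) =
    ++-interchange ((a * t , v) ∷ []) (scale a w) ((b * t , v) ∷ []) (scale b w)
    ▸ rel-++ (rel-add (a * t) (b * t) v ▸ rel-coef v (sym (distribʳ t a b))) (scale-+ a b w)

  scale-0 : ∀ {j S} (w : ⋀ j) → scale 0# w ≈ᵂ[ S ] []
  scale-0 []            = rel-refl
  scale-0 ((t , v) ∷ w) = rel-++ (rel-coef v (zeroˡ t) ▸ rel-zero v) (scale-0 w)

  ++-inverseʳ : ∀ {j S} (w : ⋀ j) → w ++ negate w ≈ᵂ[ S ] []
  ++-inverseʳ w =
    ++-congʳ (negate w) (rel-sym (scale-1 w)) ▸ scale-+ 1# (- 1#) w ▸ scale-cong w (-‿inverseʳ 1#) ▸ scale-0 w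

  scale-comm : ∀ {j S} a b (w : ⋀ j) → scale a (scale b w) ≈ᵂ[ S ] scale b (scale a w)
  scale-comm a b w = scale-scale a b w ▸ scale-cong w (*-comm a b) ▸ rel-sym (scale-scale b a w)

  ⨁ : ∀ {j k} → (Fin k → ⋀ j) → ⋀ j
  ⨁ {k = ℕ.zero}  G = []
  ⨁ {k = ℕ.suc k} G = G zero ++ ⨁ (λ i → G (suc i))

  ⨁-≡ : ∀ {j k} {G H : Fin k → ⋀ j} → (∀ i → G i ≡ H i) → ⨁ G ≡ ⨁ H
  ⨁-≡ {k = ℕ.zero}  G≡H = ≡.refl
  ⨁-≡ {k = ℕ.suc k} G≡H = ≡.cong₂ _++_ (G≡H zero) (⨁-≡ (λ i → G≡H (suc i)))

  concatMap-tabulate : ∀ {j k} {A : Set} (G : A → ⋀ j) (f : Fin k → A) → concatMap G (List.tabulate f) ≡ ⨁ (G ∘ f)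
  concatMap-tabulate {k = ℕ.zero}  G f = ≡.refl
  concatMap-tabulate {k = ℕ.suc k} G f = ≡.cong (G (f zero) ++_) (concatMap-tabulate G (f ∘ suc))

  concatMap-allFin : ∀ {j} (G : Fin n → ⋀ j) → concatMap G (List.allFin n) ≡ ⨁ G
  concatMap-allFin G = concatMap-tabulate G (λ i → i)

  ⨁-cong : ∀ {j k S} {G H : Fin k → ⋀ j} → (∀ i → G i ≈ᵂ[ S ] H i) → ⨁ G ≈ᵂ[ S ] ⨁ H
  ⨁-cong {k = ℕ.zero}  G≈H = rel-refl
  ⨁-cong {k = ℕ.suc k} G≈H = rel-++ (G≈H zero) (⨁-cong (λ i → G≈H (suc i)))

  ⨁-++ : ∀ {j k S} (G H : Fin k → ⋀ j) → ⨁ (λ i → G i ++ H i) ≈ᵂ[ S ] ⨁ G ++ ⨁ H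
  ⨁-++ {k = ℕ.zero}  G H = rel-refl
  ⨁-++ {k = ℕ.suc k} G H =
    ++-congˡ (G zero ++ H zero) (⨁-++ (G ∘ suc) (H ∘ suc)) ▸ ++-interchange (G zero) (H zero) (⨁ (G ∘ suc)) (⨁ (H ∘ suc))

  ⨁-zero : ∀ {j k S} {G : Fin k → ⋀ j} → (∀ i → G i ≈ᵂ[ S ] []) → ⨁ G ≈ᵂ[ S ] []
  ⨁-zero {k = ℕ.zero}  G≈[] = rel-refl
  ⨁-zero {k = ℕ.suc k} G≈[] = rel-++ (G≈[] zero) (⨁-zero (λ i → G≈[] (suc i)))

  ⨁-single : ∀ {j k S} (G : Fin k → ⋀ j) (e : Fin k) → (∀ i → i ≢ e → G i ≈ᵂ[ S ] []) → ⨁ G ≈ᵂ[ S ] G e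
  ⨁-single G zero    others≈[] = ++-congˡ (G zero) (⨁-zero (λ i → others≈[] (suc i) (λ ()))) ▸ ++-identityʳ (G zero)
  ⨁-single G (suc e) others≈[] =
    ++-congʳ _ (others≈[] zero (λ ())) ▸ ⨁-single (G ∘ suc) e (λ i i≢e → others≈[] (suc i) (i≢e ∘ Finₚ.suc-injective))

  scale-⨁ : ∀ {j k} a (G : Fin k → ⋀ j) → scale a (⨁ G) ≡ ⨁ (λ i → scale a (G i))
  scale-⨁ {k = ℕ.zero}  a G = ≡.refl
  scale-⨁ {k = ℕ.suc k} a G = ≡.trans (scale-++ a (G zero) _) (≡.cong (scale a (G zero) ++_) (scale-⨁ a (G ∘ suc)))

  additive-⨁ : ∀ {j j′ k S} (O : ⋀ j → ⋀ j′) → O [] ≈ᵂ[ S ] [] → (∀ x y → O (x ++ y) ≈ᵂ[ S ] O x ++ O y)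
             → (G : Fin k → ⋀ j) → O (⨁ G) ≈ᵂ[ S ] ⨁ (O ∘ G)
  additive-⨁ {k = ℕ.zero}  O O[]≈[] O-++ G = O[]≈[]
  additive-⨁ {k = ℕ.suc k} O O[]≈[] O-++ G = O-++ (G zero) _ ▸ ++-congˡ (O (G zero)) (additive-⨁ O O[]≈[] O-++ (G ∘ suc))

  value-cong : ∀ {x y} → x ≈ᴺ y → ∀ j → value x j ≈ value y j
  value-cong x≈y j = Σᴿ-cong (λ e → *-congʳ (x≈y e))

  value-0 : ∀ j → value 0ᴺ j ≈ 0#
  value-0 j = Σᴿ-zero {f = λ e → 0# * ρ̄ e j} (λ e → zeroˡ (ρ̄ e j))

  value-+ : ∀ x y j → value (λ e → x e + y e) j ≈ value x j + value y j
  value-+ x y j = trans (Σᴿ-cong (λ e → distribʳ (ρ̄ e j) (x e) (y e))) (Σᴿ-+ (λ e → x e * ρ̄ e j) (λ e → y e * ρ̄ e j))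

  value-neg : ∀ x j → value (λ e → - x e) j ≈ - value x j
  value-neg x j = trans (Σᴿ-cong (λ e → sym (-‿distribˡ-* (x e) (ρ̄ e j)))) (Σᴿ-neg (λ e → x e * ρ̄ e j))

  ≈ᴺ⇒≈ᴺ[S] : ∀ {S x y} → x ≈ᴺ y → x ≈ᴺ[ S ] y
  ≈ᴺ⇒≈ᴺ[S] x≈y = 0ᴺ , (λ _ _ → refl) , λ j → trans (value-cong x≈y j) (sym (trans (+-congˡ (value-0 j)) (+-identityʳ _)))

  agreeOff⇒≈ᴺ[S] : ∀ {S x y} → (∀ e → ¬ (e ∈ₛ S) → x e ≈ y e) → x ≈ᴺ[ S ] y
  agreeOff⇒≈ᴺ[S] {S} {x} {y} agree = difference , difference-off , λ j → trans (value-cong split j) (value-+ y _ j)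
    where
    difference : Nᶜ
    difference e with e ∈? S
    ... | yes _ = x e + - y e
    ... | no  _ = 0#

    difference-off : ∀ e → ¬ (e ∈ₛ S) → difference e ≈ 0#
    difference-off e e∉S with e ∈? S
    ... | yes e∈S = ⊥-elim (e∉S e∈S)
    ... | no  _   = refl

    split : ∀ e → x e ≈ y e + difference e
    split e with e ∈? S
    ... | yes _   = sym (trans (+-congˡ (+-comm _ _)) (trans (sym (+-assoc _ _ _)) (trans (+-congʳ (-‿inverseʳ (y e))) (+-identityˡ _))))
    ... | no  e∉S = trans (agree e e∉S) (sym (+-identityʳ _))

  prepend : ∀ {j} → Nᶜ → ⋀ j → ⋀ (ℕ.suc j)
  prepend y w = map (λ { (a , v) → (a , y ∷ v) }) w

  prepend-++ : ∀ {j} y (x z : ⋀ j) → prepend y (x ++ z) ≡ prepend y x ++ prepend y z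
  prepend-++ y []      z = ≡.refl
  prepend-++ y (t ∷ x) z = ≡.cong (_ ∷_) (prepend-++ y x z)

  prepend-scale : ∀ {j} y a (w : ⋀ j) → prepend y (scale a w) ≡ scale a (prepend y w)
  prepend-scale y a []            = ≡.refl
  prepend-scale y a ((b , v) ∷ w) = ≡.cong ((a * b , y ∷ v) ∷_) (prepend-scale y a w)

  prepend-cong : ∀ {j S} y {w w′ : ⋀ j} → w ≈ᵂ[ S ] w′ → prepend y w ≈ᵂ[ S ] prepend y w′
  prepend-cong y rel-refl                  = rel-refl
  prepend-cong y (rel-sym w≈w′)            = rel-sym (prepend-cong y w≈w′)
  prepend-cong y (rel-trans w≈w′ w′≈w″)    = rel-trans (prepend-cong y w≈w′) (prepend-cong y w′≈w″)
  prepend-cong y (rel-++ {x} {x′} {z} {z′} x≈x′ z≈z′) =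
    ≡⇒≈ᵂ (prepend-++ y x z) ▸ rel-++ (prepend-cong y x≈x′) (prepend-cong y z≈z′) ▸ ≡⇒≈ᵂ (≡.sym (prepend-++ y x′ z′))
  prepend-cong y (rel-· a {x} {z} x≈z)     =
    ≡⇒≈ᵂ (prepend-scale y a x) ▸ rel-· a (prepend-cong y x≈z) ▸ ≡⇒≈ᵂ (≡.sym (prepend-scale y a z))
  prepend-cong y (rel-comm x z)            =
    ≡⇒≈ᵂ (prepend-++ y x z) ▸ rel-comm (prepend y x) (prepend y z) ▸ ≡⇒≈ᵂ (≡.sym (prepend-++ y z x))
  prepend-cong y (rel-zero v)              = rel-zero (y ∷ v)
  prepend-cong y (rel-coef v a≈b)          = rel-coef (y ∷ v) a≈b
  prepend-cong y (rel-add a b v)           = rel-add a b (y ∷ v)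
  prepend-cong y (rel-entry a v i x z x≈z) = rel-entry a (y ∷ v) (suc i) x z x≈z
  prepend-cong y (rel-lin+ a v i x z)      = rel-lin+ a (y ∷ v) (suc i) x z
  prepend-cong y (rel-lin· a v i b x)      = rel-lin· a (y ∷ v) (suc i) b x
  prepend-cong y (rel-alt a v i k x i≢k)   = rel-alt a (y ∷ v) (suc i) (suc k) x (i≢k ∘ Finₚ.suc-injective)

  entrywise-cong : ∀ {j S} a (v v′ : Vec Nᶜ j) → (∀ k → lookup v k ≈ᴺ[ S ] lookup v′ k) → (a , v) ∷ [] ≈ᵂ[ S ] (a , v′) ∷ []
  entrywise-cong a []      []        _       = rel-refl
  entrywise-cong a (x ∷ v) (x′ ∷ v′) v≈v′ =
    rel-entry a (x ∷ v) zero x x′ (v≈v′ zero) ▸ prepend-cong x′ (entrywise-cong a v v′ (λ k → v≈v′ (suc k)))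

  mapᵂ : ∀ {j} → (Nᶜ → Nᶜ) → ⋀ j → ⋀ j
  mapᵂ f w = map (λ { (a , v) → (a , Vec.map f v) }) w

  mapᵂ-++ : ∀ {j} f (x z : ⋀ j) → mapᵂ f (x ++ z) ≡ mapᵂ f x ++ mapᵂ f z
  mapᵂ-++ f []      z = ≡.refl
  mapᵂ-++ f (t ∷ x) z = ≡.cong (_ ∷_) (mapᵂ-++ f x z)

  mapᵂ-scale : ∀ {j} f a (w : ⋀ j) → mapᵂ f (scale a w) ≡ scale a (mapᵂ f w)
  mapᵂ-scale f a []            = ≡.refl
  mapᵂ-scale f a ((b , v) ∷ w) = ≡.cong ((a * b , Vec.map f v) ∷_) (mapᵂ-scale f a w)

  module _ (f : Nᶜ → Nᶜ) {S₁ S₂ : Subset n}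
           (f-+ : ∀ x y → f (x +ₙ y) ≈ᴺ f x +ₙ f y)
           (f-· : ∀ b x → f (b ·ₙ x) ≈ᴺ b ·ₙ f x)
           (f-cong : ∀ x y → x ≈ᴺ[ S₁ ] y → f x ≈ᴺ[ S₂ ] f y) where

    private
      map-update : ∀ {j} a (v : Vec Nᶜ j) i x → (a , Vec.map f (v [ i ]≔ x)) ∷ [] ≈ᵂ[ S₂ ] (a , Vec.map f v [ i ]≔ f x) ∷ []
      map-update a v i x = ≡⇒≈ᵂ (≡.cong (λ u → (a , u) ∷ []) (Vecₚ.map-[]≔ f v i))

    mapᵂ-cong : ∀ {j} {w w′ : ⋀ j} → w ≈ᵂ[ S₁ ] w′ → mapᵂ f w ≈ᵂ[ S₂ ] mapᵂ f w′
    mapᵂ-cong rel-refl               = rel-refl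
    mapᵂ-cong (rel-sym w≈w′)         = rel-sym (mapᵂ-cong w≈w′)
    mapᵂ-cong (rel-trans w≈w′ w′≈w″) = rel-trans (mapᵂ-cong w≈w′) (mapᵂ-cong w′≈w″)
    mapᵂ-cong (rel-++ {x} {x′} {z} {z′} x≈x′ z≈z′) =
      ≡⇒≈ᵂ (mapᵂ-++ f x z) ▸ rel-++ (mapᵂ-cong x≈x′) (mapᵂ-cong z≈z′) ▸ ≡⇒≈ᵂ (≡.sym (mapᵂ-++ f x′ z′))
    mapᵂ-cong (rel-· a {x} {z} x≈z)  = ≡⇒≈ᵂ (mapᵂ-scale f a x) ▸ rel-· a (mapᵂ-cong x≈z) ▸ ≡⇒≈ᵂ (≡.sym (mapᵂ-scale f a z))
    mapᵂ-cong (rel-comm x z)         = ≡⇒≈ᵂ (mapᵂ-++ f x z) ▸ rel-comm (mapᵂ f x) (mapᵂ f z) ▸ ≡⇒≈ᵂ (≡.sym (mapᵂ-++ f z x))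
    mapᵂ-cong (rel-zero v)           = rel-zero _
    mapᵂ-cong (rel-coef v a≈b)       = rel-coef _ a≈b
    mapᵂ-cong (rel-add a b v)        = rel-add a b _
    mapᵂ-cong (rel-entry a v i x z x≈z) =
      map-update a v i x ▸ rel-entry a (Vec.map f v) i (f x) (f z) (f-cong x z x≈z) ▸ rel-sym (map-update a v i z)
    mapᵂ-cong (rel-lin+ a v i x z) =
      map-update a v i (x +ₙ z)
      ▸ rel-entry a (Vec.map f v) i _ _ (≈ᴺ⇒≈ᴺ[S] (f-+ x z)) ▸ rel-lin+ a (Vec.map f v) i (f x) (f z)
      ▸ rel-sym (rel-++ (map-update a v i x) (map-update a v i z))
    mapᵂ-cong (rel-lin· a v i b x) =
      map-update a v i (b ·ₙ x)
      ▸ rel-entry a (Vec.map f v) i _ _ (≈ᴺ⇒≈ᴺ[S] (f-· b x)) ▸ rel-lin· a (Vec.map f v) i b (f x)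
      ▸ rel-sym (map-update (a * b) v i x)
    mapᵂ-cong (rel-alt a v i k x i≢k) =
      ≡⇒≈ᵂ (≡.cong (λ u → (a , u) ∷ []) (≡.trans (Vecₚ.map-[]≔ f (v [ i ]≔ x) k) (≡.cong (_[ k ]≔ f x) (Vecₚ.map-[]≔ f v i))))
      ▸ rel-alt a (Vec.map f v) i k (f x) i≢k

  module _ (independent : LinearlyIndependent R ρ̄) where

    ≈ᴺ[S]⇒agreeOff : ∀ {S x y} → x ≈ᴺ[ S ] y → ∀ e → lookup S e ≡ false → x e ≈ y e
    ≈ᴺ[S]⇒agreeOff {S} {x} {y} (s , s-off , x≈y+s) e e∉S =
      trans (x∙y⁻¹≈ε⇒x≈y _ _ (independent r r≈0 e))
            (trans (+-congˡ (s-off e (lookup≡false⇒∉ e∉S))) (+-identityʳ _))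
      where
      r : Nᶜ
      r f = x f + - (y f + s f)

      r≈0 : ∀ j → value r j ≈ 0#
      r≈0 j = begin
        value r j                                            ≈⟨ value-+ x (λ f → - (y f + s f)) j ⟩
        value x j + value (λ f → - (y f + s f)) j            ≈⟨ +-congˡ (value-neg (λ f → y f + s f) j) ⟩
        value x j + - value (λ f → y f + s f) j              ≈⟨ +-congˡ (-‿cong (value-+ y s j)) ⟩
        value x j + - (value y j + value s j)                ≈⟨ +-congʳ (x≈y+s j) ⟩
        (value y j + value s j) + - (value y j + value s j)  ≈⟨ -‿inverseʳ _ ⟩
        0#                                                   ∎

module BasisWedges {c ℓ : Level} (R : CommutativeRing c ℓ) {n m : ℕ} (ρ̄ : Fin n → Fin m → CommutativeRing.Carrier R) where
  open RingFacts R
  open ExteriorCalculus R ρ̄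

  zero-entry : ∀ {j S} a (v : Vec Nᶜ j) k → (a , v [ k ]≔ 0ᴺ) ∷ [] ≈ᵂ[ S ] []
  zero-entry a v k =
    rel-entry a v k 0ᴺ (0# ·ₙ 0ᴺ) (≈ᴺ⇒≈ᴺ[S] (λ _ → sym (zeroˡ 0#))) ▸ rel-lin· a v k 0# 0ᴺ
    ▸ rel-coef (v [ k ]≔ 0ᴺ) (zeroʳ a) ▸ rel-zero _

  zero-entry′ : ∀ {j S} a (v : Vec Nᶜ j) k → lookup v k ≈ᴺ 0ᴺ → (a , v) ∷ [] ≈ᵂ[ S ] []
  zero-entry′ a v k vₖ≈0 =
    ≡⇒≈ᵂ (≡.cong (λ u → (a , u) ∷ []) (≡.sym (Vecₚ.[]≔-lookup v k)))
    ▸ rel-entry a v k (lookup v k) 0ᴺ (≈ᴺ⇒≈ᴺ[S] vₖ≈0) ▸ zero-entry a v k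

  equal-entries⇒≈[] : ∀ {j S} b (u : Vec Nᶜ j) {i k} → i ≢ k → lookup u i ≡ lookup u k → (b , u) ∷ [] ≈ᵂ[ S ] []
  equal-entries⇒≈[] b u {i} {k} i≢k uᵢ≡uₖ =
    ≡⇒≈ᵂ (≡.cong (λ z → (b , z) ∷ []) (≡.sym u≡)) ▸ rel-alt b u i k (lookup u i) i≢k
    where
    u≡ : (u [ i ]≔ lookup u i) [ k ]≔ lookup u i ≡ u
    u≡ = ≡.trans (≡.cong (λ z → z [ k ]≔ lookup u i) (Vecₚ.[]≔-lookup u i))
                 (≡.trans (≡.cong (u [ k ]≔_) uᵢ≡uₖ) (Vecₚ.[]≔-lookup u k))

  sumᴺ : ∀ {k} → (Fin k → Nᶜ) → Nᶜ
  sumᴺ g e = Σᴿ R (λ i → g i e)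

  first-entry-sum : ∀ {k j S} a (g : Fin k → Nᶜ) (v : Vec Nᶜ j) → (a , sumᴺ g ∷ v) ∷ [] ≈ᵂ[ S ] ⨁ (λ i → (a , g i ∷ v) ∷ [])
  first-entry-sum {ℕ.zero}  a g v = zero-entry a (0ᴺ ∷ v) zero
  first-entry-sum {ℕ.suc k} a g v =
    rel-lin+ a (sumᴺ g ∷ v) zero (g zero) (sumᴺ (λ i → g (suc i)))
    ▸ ++-congˡ ((a , g zero ∷ v) ∷ []) (first-entry-sum a (λ i → g (suc i)) v)

  unit-decomposition : ∀ x → x ≈ᴺ sumᴺ (λ e → x e ·ₙ unit e)
  unit-decomposition x f = sym (begin
    Σᴿ R (λ e → x e * unit e f)
      ≈⟨ Σᴿ-single (λ e → x e * unit e f) f (λ e e≢f → trans (*-congˡ (unit-other (e≢f ∘ ≡.sym))) (zeroʳ _)) ⟩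
    x f * unit f f              ≈⟨ *-congˡ (unit-same f) ⟩
    x f * 1#                    ≈⟨ *-identityʳ _ ⟩
    x f                         ∎)

  first-entry-expand : ∀ {j S} a x (v : Vec Nᶜ j) → (a , x ∷ v) ∷ [] ≈ᵂ[ S ] ⨁ (λ e → (a * x e , unit e ∷ v) ∷ [])
  first-entry-expand a x v =
    rel-entry a (x ∷ v) zero x _ (≈ᴺ⇒≈ᴺ[S] (unit-decomposition x)) ▸ first-entry-sum a (λ e → x e ·ₙ unit e) v
    ▸ ⨁-cong (λ e → rel-lin· a (unit e ∷ v) zero (x e) (unit e))

  BasisTerm : ℕ → Set c
  BasisTerm j = Carrier × Vec (Fin n) j

  basisTerm : ∀ {j} → BasisTerm j → Term R ρ̄ j
  basisTerm (b , σ) = (b , Vec.map unit σ)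

  basisWedge : ∀ {j} → List (BasisTerm j) → ⋀ j
  basisWedge L = map basisTerm L

  ⨁ˡ : ∀ {j k} → (Fin k → List (BasisTerm j)) → List (BasisTerm j)
  ⨁ˡ {k = ℕ.zero}  G = []
  ⨁ˡ {k = ℕ.suc k} G = G zero ++ ⨁ˡ (λ i → G (suc i))

  basisWedge-⨁ˡ : ∀ {j k} (G : Fin k → List (BasisTerm j)) → basisWedge (⨁ˡ G) ≡ ⨁ (λ i → basisWedge (G i))
  basisWedge-⨁ˡ {k = ℕ.zero}  G = ≡.refl
  basisWedge-⨁ˡ {k = ℕ.suc k} G =
    ≡.trans (Listₚ.map-++ basisTerm (G zero) _) (≡.cong (basisWedge (G zero) ++_) (basisWedge-⨁ˡ (λ i → G (suc i))))

  prependIndex : ∀ {j} → Fin n → List (BasisTerm j) → List (BasisTerm (ℕ.suc j))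
  prependIndex e L = map (λ { (b , σ) → (b , e ∷ σ) }) L

  prepend-basisWedge : ∀ {j} e (L : List (BasisTerm j)) → prepend (unit e) (basisWedge L) ≡ basisWedge (prependIndex e L)
  prepend-basisWedge e []            = ≡.refl
  prepend-basisWedge e ((b , σ) ∷ L) = ≡.cong ((b , unit e ∷ Vec.map unit σ) ∷_) (prepend-basisWedge e L)

  expand-term : ∀ {j S} a (v : Vec Nᶜ j) → ∃ λ (L : List (BasisTerm j)) → (a , v) ∷ [] ≈ᵂ[ S ] basisWedge L
  expand-term a []      = (a , []) ∷ [] , rel-refl
  expand-term {S = S} a (x ∷ v) =
    ⨁ˡ (λ e → prependIndex e (proj₁ (expand-rest e))) ,
    (first-entry-expand a x v
     ▸ ⨁-cong (λ e → prepend-cong (unit e) (proj₂ (expand-rest e)) ▸ ≡⇒≈ᵂ (prepend-basisWedge e (proj₁ (expand-rest e))))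
     ▸ ≡⇒≈ᵂ (≡.sym (basisWedge-⨁ˡ (λ e → prependIndex e (proj₁ (expand-rest e))))))
    where
    expand-rest : ∀ e → ∃ λ (L : List (BasisTerm _)) → (a * x e , v) ∷ [] ≈ᵂ[ S ] basisWedge L
    expand-rest e = expand-term (a * x e) v

  expand : ∀ {j S} (w : ⋀ j) → ∃ λ (L : List (BasisTerm j)) → w ≈ᵂ[ S ] basisWedge L
  expand []            = [] , rel-refl
  expand ((a , v) ∷ w) with expand-term a v | expand w
  ... | L₁ , v≈L₁ | L₂ , w≈L₂ = L₁ ++ L₂ , (rel-++ v≈L₁ w≈L₂ ▸ ≡⇒≈ᵂ (≡.sym (Listₚ.map-++ basisTerm L₁ L₂)))

  lookup-map-unit : ∀ {j} (σ : Vec (Fin n) j) k → lookup (Vec.map unit σ) k ≡ unit (lookup σ k)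
  lookup-map-unit σ k = Vecₚ.lookup-map k unit σ

  repeated-index⇒≈[] : ∀ {j S} b (σ : Vec (Fin n) j) {i k} → i ≢ k → lookup σ i ≡ lookup σ k → (b , Vec.map unit σ) ∷ [] ≈ᵂ[ S ] []
  repeated-index⇒≈[] b σ {i} {k} i≢k σᵢ≡σₖ =
    equal-entries⇒≈[] b (Vec.map unit σ) i≢k
      (≡.trans (lookup-map-unit σ i) (≡.trans (≡.cong unit σᵢ≡σₖ) (≡.sym (lookup-map-unit σ k))))

  x++y≈[]⇒x≈-y : ∀ {j S} (x y : ⋀ j) → x ++ y ≈ᵂ[ S ] [] → x ≈ᵂ[ S ] negate y
  x++y≈[]⇒x≈-y x y x++y≈[] =
    rel-sym (++-identityʳ x) ▸ ++-congˡ x (rel-sym (++-inverseʳ y)) ▸ rel-sym (++-assoc x y (negate y)) ▸ ++-congʳ (negate y) x++y≈[]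

  swap-first-two : ∀ {k S} a (x y : Nᶜ) (r : Vec Nᶜ k) → (a , x ∷ y ∷ r) ∷ [] ≈ᵂ[ S ] (- a , y ∷ x ∷ r) ∷ []
  swap-first-two {S = S} a x y r = x++y≈[]⇒x≈-y _ _ xy+yx≈[] ▸ rel-coef (y ∷ x ∷ r) (-1*x≈-x a)
    where
    t : Nᶜ → Nᶜ → Term R ρ̄ _
    t u v = (a , u ∷ v ∷ r)

    alternating : ∀ u → t u u ∷ [] ≈ᵂ[ S ] []
    alternating u = rel-alt a (u ∷ u ∷ r) zero (suc zero) u (λ ())

    bilinear : t (x +ₙ y) (x +ₙ y) ∷ [] ≈ᵂ[ S ] (t x x ∷ t x y ∷ []) ++ (t y x ∷ t y y ∷ [])
    bilinear = rel-lin+ a (x +ₙ y ∷ x +ₙ y ∷ r) zero x y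
               ▸ rel-++ (rel-lin+ a (x ∷ x +ₙ y ∷ r) (suc zero) x y) (rel-lin+ a (y ∷ x +ₙ y ∷ r) (suc zero) x y)

    xy+yx≈[] : t x y ∷ t y x ∷ [] ≈ᵂ[ S ] []
    xy+yx≈[] = rel-sym (rel-++ (rel-++ (alternating x) (rel-refl {x = t x y ∷ []})) (rel-++ (rel-refl {x = t y x ∷ []}) (alternating y))
                        ▸ ++-identityʳ (t x y ∷ t y x ∷ []))
               ▸ rel-sym bilinear ▸ alternating (x +ₙ y)

  move-to-front : ∀ {k S} b (u : Vec Nᶜ (ℕ.suc k)) l
                → (b , u) ∷ [] ≈ᵂ[ S ] (signPow R (toℕ l) * b , lookup u l ∷ removeAt u l) ∷ []
  move-to-front b (x ∷ u)     zero    = rel-coef (x ∷ u) (sym (*-identityˡ b))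
  move-to-front b (x ∷ y ∷ u) (suc l) =
    prepend-cong x (move-to-front b (y ∷ u) l) ▸ swap-first-two _ x _ _ ▸ rel-coef _ (-‿distribˡ-* _ b)

  Covers : ∀ {k} → Vec (Fin n) k → Fin n → Set
  Covers τ x = ∃ λ p → lookup τ p ≡ x

  covers-tail : ∀ {k t x} {τ : Vec (Fin n) k} → Covers (t ∷ τ) x → t ≢ x → Covers τ x
  covers-tail (zero  , t≡x) t≢x = ⊥-elim (t≢x t≡x)
  covers-tail (suc p , τp≡x) _  = p , τp≡x

  reorder : ∀ {k S} (τ σ : Vec (Fin n) k) → (∀ i → Covers τ (lookup σ i)) → ∀ b
          → ∃ λ b′ → (b , Vec.map unit σ) ∷ [] ≈ᵂ[ S ] (b′ , Vec.map unit τ) ∷ []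
  reorder [] [] _ b = b , rel-refl
  reorder {ℕ.suc k} {S} (t ∷ τ) σ covered b with repetition? σ
  ... | yes (i , i′ , i≢i′ , σᵢ≡σᵢ′) = 0# , (repeated-index⇒≈[] b σ i≢i′ σᵢ≡σᵢ′ ▸ rel-sym (rel-zero _))
  ... | no distinct with Finₚ.any? (λ l → lookup σ l Finₚ.≟ t)
  ...   | no t∉σ =
    ⊥-elim (distinct (pigeonhole-cover (ℕₚ.n<1+n k) τ (lookup σ) (λ i → covers-tail (covered i) (t∉σ ∘ (i ,_) ∘ ≡.sym))))
  ...   | yes (l , σₗ≡t) with reorder {S = S} τ (removeAt σ l) covered′ (signPow R (toℕ l) * b)
    where
    covered′ : ∀ i → Covers τ (lookup (removeAt σ l) i)
    covered′ i = ≡.subst (Covers τ) (≡.sym (lookup-removeAt σ l i))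
                   (covers-tail (covered (punchIn l i))
                     (λ t≡σ → distinct (punchIn l i , l , Finₚ.punchInᵢ≢i l i , ≡.trans (≡.sym t≡σ) (≡.sym σₗ≡t))))
  ...     | b′ , rest≈b′ = b′ , (move-to-front b (Vec.map unit σ) l ▸ ≡⇒≈ᵂ front≡t ▸ prepend-cong (unit t) rest≈b′)
    where
    front≡t : (signPow R (toℕ l) * b , lookup (Vec.map unit σ) l ∷ removeAt (Vec.map unit σ) l) ∷ []
            ≡ (signPow R (toℕ l) * b , unit t ∷ Vec.map unit (removeAt σ l)) ∷ []
    front≡t = ≡.cong₂ (λ u v → (signPow R (toℕ l) * b , u ∷ v) ∷ [])
                      (≡.trans (lookup-map-unit σ l) (≡.cong unit σₗ≡t)) (map-removeAt unit σ l)

  standardWedge : Vec Nᶜ n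
  standardWedge = Vec.map unit (Vec.allFin n)

  collect : ∀ {S} (L : List (BasisTerm n)) → ∃ λ b → basisWedge L ≈ᵂ[ S ] (b , standardWedge) ∷ []
  collect []            = 0# , rel-sym (rel-zero standardWedge)
  collect {S} ((b , σ) ∷ L)
    with reorder {S = S} (Vec.allFin n) σ (λ i → lookup σ i , Vecₚ.lookup-allFin (lookup σ i)) b | collect {S} L
  ... | b₁ , σ≈b₁ | b₂ , L≈b₂ = b₁ + b₂ , (rel-++ σ≈b₁ L≈b₂ ▸ rel-add b₁ b₂ standardWedge)

  top-degree-cyclic : ∀ {S} (w : ⋀ n) → ∃ λ b → w ≈ᵂ[ S ] (b , standardWedge) ∷ []
  top-degree-cyclic {S} w with expand {S = S} w
  ... | L , w≈L with collect {S} L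
  ...   | b , L≈b = b , (w≈L ▸ L≈b)

module KoszulHomotopy {c ℓ : Level} (R : CommutativeRing c ℓ) {n m : ℕ} (ρ̄ : Fin n → Fin m → CommutativeRing.Carrier R)
                      (independent : LinearlyIndependent R ρ̄) where
  open RingFacts R
  open ExteriorCalculus R ρ̄
  open BasisWedges R ρ̄

  π : Fin n → Nᶜ → Nᶜ
  π e x f = if does (f Finₚ.≟ e) then 0# else x f

  π-other : ∀ {e f} x → f ≢ e → π e x f ≈ x f
  π-other {e} {f} x f≢e with f Finₚ.≟ e
  ... | yes f≡e = ⊥-elim (f≢e f≡e)
  ... | no  _   = refl

  π-+ : ∀ e x y → π e (x +ₙ y) ≈ᴺ π e x +ₙ π e y
  π-+ e x y f with f Finₚ.≟ e
  ... | yes _ = sym (+-identityʳ 0#)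
  ... | no  _ = refl

  π-· : ∀ e b x → π e (b ·ₙ x) ≈ᴺ b ·ₙ π e x
  π-· e b x f with f Finₚ.≟ e
  ... | yes _ = sym (zeroʳ b)
  ... | no  _ = refl

  π-cong : ∀ {S₁ S₂} e → (∀ f → lookup S₂ f ≡ false → f ≢ e → lookup S₁ f ≡ false)
         → ∀ x y → x ≈ᴺ[ S₁ ] y → π e x ≈ᴺ[ S₂ ] π e y
  π-cong {S₁} {S₂} e S₂∪e⊇S₁ x y x≈y = agreeOff⇒≈ᴺ[S] (λ f f∉S₂ → agree f (∉⇒lookup≡false f∉S₂))
    where
    agree : ∀ f → lookup S₂ f ≡ false → π e x f ≈ π e y f
    agree f f∉S₂ with f Finₚ.≟ e
    ... | yes _   = refl
    ... | no  f≢e = ≈ᴺ[S]⇒agreeOff independent x≈y f (S₂∪e⊇S₁ f f∉S₂ f≢e)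

  π≈id : ∀ {S e} → lookup S e ≡ true → ∀ x → π e x ≈ᴺ[ S ] x
  π≈id {S} e∈S x = agreeOff⇒≈ᴺ[S] λ f f∉S →
    π-other x λ f≡e → f∉S (≡.subst (_∈ₛ S) (≡.sym f≡e) (lookup≡true⇒∈ e∈S))

  ⋀π : Fin n → ∀ {j} → ⋀ j → ⋀ j
  ⋀π e = mapᵂ (π e)

  ⋀π-cong-insert : ∀ {j S e} {w w′ : ⋀ j} → w ≈ᵂ[ insert e S ] w′ → ⋀π e w ≈ᵂ[ S ] ⋀π e w′
  ⋀π-cong-insert {S = S} {e} =
    mapᵂ-cong (π e) (π-+ e) (π-· e) (π-cong e (λ f f∉S f≢e → ≡.trans (lookup-insert′ S f≢e) f∉S))

  ⋀π-cong : ∀ {j S e} {w w′ : ⋀ j} → w ≈ᵂ[ S ] w′ → ⋀π e w ≈ᵂ[ S ] ⋀π e w′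
  ⋀π-cong {e = e} = mapᵂ-cong (π e) (π-+ e) (π-· e) (π-cong e (λ f f∉S _ → f∉S))

  ⋀π≈id : ∀ {j S e} → lookup S e ≡ true → (w : ⋀ j) → ⋀π e w ≈ᵂ[ S ] w
  ⋀π≈id e∈S [] = rel-refl
  ⋀π≈id {S = S} {e} e∈S ((a , v) ∷ w) = rel-++ (entrywise-cong a (Vec.map (π e) v) v entries) (⋀π≈id e∈S w)
    where
    entries : ∀ k → lookup (Vec.map (π e) v) k ≈ᴺ[ S ] lookup v k
    entries k = ≡.subst (_≈ᴺ[ S ] lookup v k) (≡.sym (Vecₚ.lookup-map k (π e) v)) (π≈id e∈S (lookup v k))

  ⋀π-++ : ∀ {j} e (x z : ⋀ j) → ⋀π e (x ++ z) ≡ ⋀π e x ++ ⋀π e z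
  ⋀π-++ e = mapᵂ-++ (π e)

  ⋀π-scale : ∀ {j} e a (w : ⋀ j) → ⋀π e (scale a w) ≡ scale a (⋀π e w)
  ⋀π-scale e = mapᵂ-scale (π e)

  ⋀π-⨁ : ∀ {j k} e (G : Fin k → ⋀ j) → ⋀π e (⨁ G) ≡ ⨁ (λ i → ⋀π e (G i))
  ⋀π-⨁ {k = ℕ.zero}  e G = ≡.refl
  ⋀π-⨁ {k = ℕ.suc k} e G = ≡.trans (⋀π-++ e (G zero) _) (≡.cong (⋀π e (G zero) ++_) (⋀π-⨁ e (λ i → G (suc i))))

  P : Fin n → ∀ {j} → ⋀ j → ⋀ j
  P e w = w ++ negate (⋀π e w)

  P-cong : ∀ {j S e} {w w′ : ⋀ j} → w ≈ᵂ[ S ] w′ → P e w ≈ᵂ[ S ] P e w′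
  P-cong w≈w′ = rel-++ w≈w′ (rel-· (- 1#) (⋀π-cong w≈w′))

  P-++ : ∀ {j S} e (x z : ⋀ j) → P e (x ++ z) ≈ᵂ[ S ] P e x ++ P e z
  P-++ e x z =
    ≡⇒≈ᵂ (≡.cong ((x ++ z) ++_) (≡.trans (≡.cong negate (⋀π-++ e x z)) (scale-++ (- 1#) (⋀π e x) (⋀π e z))))
    ▸ ++-interchange x z (negate (⋀π e x)) (negate (⋀π e z))

  P-scale : ∀ {j S} e a (w : ⋀ j) → P e (scale a w) ≈ᵂ[ S ] scale a (P e w)
  P-scale e a w =
    ≡⇒≈ᵂ (≡.cong (λ z → scale a w ++ negate z) (⋀π-scale e a w))
    ▸ ++-congˡ (scale a w) (scale-comm (- 1#) a (⋀π e w))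
    ▸ ≡⇒≈ᵂ (≡.sym (scale-++ a w (negate (⋀π e w))))

  P-vanish : ∀ {j S e} → lookup S e ≡ true → (w : ⋀ j) → P e w ≈ᵂ[ S ] []
  P-vanish e∈S w = ++-congˡ w (rel-· (- 1#) (⋀π≈id e∈S w)) ▸ ++-inverseʳ w

  Pᴸ : List (Fin n) → ∀ {j} → ⋀ j → ⋀ j
  Pᴸ []      w = w
  Pᴸ (e ∷ L) w = P e (Pᴸ L w)

  Pᴸ-cong : ∀ {j S} L {w w′ : ⋀ j} → w ≈ᵂ[ S ] w′ → Pᴸ L w ≈ᵂ[ S ] Pᴸ L w′
  Pᴸ-cong []      w≈w′ = w≈w′
  Pᴸ-cong (e ∷ L) w≈w′ = P-cong (Pᴸ-cong L w≈w′)

  Pᴸ-++ : ∀ {j S} L (x z : ⋀ j) → Pᴸ L (x ++ z) ≈ᵂ[ S ] Pᴸ L x ++ Pᴸ L z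
  Pᴸ-++ []      x z = rel-refl
  Pᴸ-++ (e ∷ L) x z = P-cong (Pᴸ-++ L x z) ▸ P-++ e (Pᴸ L x) (Pᴸ L z)

  Pᴸ-[] : ∀ {j} L → Pᴸ L {j} [] ≡ []
  Pᴸ-[]     []      = ≡.refl
  Pᴸ-[] {j} (e ∷ L) = ≡.cong (P e) (Pᴸ-[] {j} L)

  Pᴸ-vanish : ∀ {j S e L} → e ∈ₗ L → lookup S e ≡ true → (w : ⋀ j) → Pᴸ L w ≈ᵂ[ S ] []
  Pᴸ-vanish {L = e ∷ L} (here ≡.refl) e∈S w = P-vanish e∈S (Pᴸ L w)
  Pᴸ-vanish {L = _ ∷ L} (there e∈L)   e∈S w = P-cong (Pᴸ-vanish e∈L e∈S w)

  C : ℕ → Set c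
  C j = Cochain R ρ̄ j

  infix 4 _≈ᶜ[_]_

  _≈ᶜ[_]_ : ∀ {j} → C j → ℕ → C j → Set (c ⊔ ℓ)
  x ≈ᶜ[ i ] y = _≈C[_]_ R ρ̄ x i y

  δ : ∀ {j} → C j → C j
  δ = d R ρ̄

  sign : Subset n → Fin n → Carrier
  sign = ε R ρ̄

  piece : ∀ {j} (y : C j) (T : Subset n) → Fin n → ⋀ j
  piece y T f = if lookup T f then scale (sign (T ─ ⁅ f ⁆) f) (y (T ─ ⁅ f ⁆)) else []

  piece-∈ : ∀ {j} (y : C j) {T f} → lookup T f ≡ true → piece y T f ≡ scale (sign (T ─ ⁅ f ⁆) f) (y (T ─ ⁅ f ⁆))
  piece-∈ y f∈T rewrite f∈T = ≡.refl

  piece-∉ : ∀ {j} (y : C j) {T f} → lookup T f ≡ false → piece y T f ≡ []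
  piece-∉ y f∉T rewrite f∉T = ≡.refl

  -- Defs writes the summands of d with a local if_then_else_ on does (f ∈? T); summand names
  -- them so that they can be compared with piece by case analysis.
  summand : ∀ {j} (y : C j) (T : Subset n) → Σ (Fin n → ⋀ j) λ G → δ y T ≡ concatMap G (List.allFin n)
  summand y T = _ , ≡.refl

  summand≡piece : ∀ {j} (y : C j) T f → proj₁ (summand y T) f ≡ piece y T f
  summand≡piece y T f rewrite ≡.sym (lookup-∈? f T) with does (f ∈? T)
  ... | true  = ≡.refl
  ... | false = ≡.refl

  δ-⨁ : ∀ {j} (y : C j) T → δ y T ≡ ⨁ (piece y T)
  δ-⨁ y T = ≡.trans (concatMap-allFin (proj₁ (summand y T))) (⨁-≡ (summand≡piece y T))

  δ-++ : ∀ {j} (y z : C j) T → δ (λ U → y U ++ z U) T ≈ᵂ[ T ] δ y T ++ δ z T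
  δ-++ y z T =
    ≡⇒≈ᵂ (δ-⨁ (λ U → y U ++ z U) T) ▸ ⨁-cong pieces ▸ ⨁-++ (piece y T) (piece z T)
    ▸ rel-++ (≡⇒≈ᵂ (≡.sym (δ-⨁ y T))) (≡⇒≈ᵂ (≡.sym (δ-⨁ z T)))
    where
    pieces : ∀ f → piece (λ U → y U ++ z U) T f ≈ᵂ[ T ] piece y T f ++ piece z T f
    pieces f with lookup T f
    ... | true  = ≡⇒≈ᵂ (scale-++ (sign (T ─ ⁅ f ⁆) f) (y (T ─ ⁅ f ⁆)) (z (T ─ ⁅ f ⁆)))
    ... | false = rel-refl

  δ-P : ∀ {j} e (y : C j) T → δ (λ U → P e (y U)) T ≈ᵂ[ T ] P e (δ y T)
  δ-P e y T =
    ≡⇒≈ᵂ (δ-⨁ (λ U → P e (y U)) T) ▸ ⨁-cong pieces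
    ▸ rel-sym (additive-⨁ (P e) rel-refl (P-++ e) (piece y T)) ▸ P-cong (≡⇒≈ᵂ (≡.sym (δ-⨁ y T)))
    where
    pieces : ∀ f → piece (λ U → P e (y U)) T f ≈ᵂ[ T ] P e (piece y T f)
    pieces f with lookup T f
    ... | true  = rel-sym (P-scale e (sign (T ─ ⁅ f ⁆) f) (y (T ─ ⁅ f ⁆)))
    ... | false = rel-refl

  δ-empty : ∀ {j} (y : C j) T → (∀ f → lookup T f ≡ false) → δ y T ≈ᵂ[ T ] []
  δ-empty y T T≡∅ = ≡⇒≈ᵂ (δ-⨁ y T) ▸ ⨁-zero (λ f → ≡⇒≈ᵂ (piece-∉ y (T≡∅ f)))

  δ-[] : ∀ {j} T → δ {j} (λ _ → []) T ≈ᵂ[ T ] []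
  δ-[] {j} T = ≡⇒≈ᵂ (δ-⨁ (λ _ → []) T) ▸ ⨁-zero pieces
    where
    pieces : ∀ f → piece {j} (λ _ → []) T f ≈ᵂ[ T ] []
    pieces f with lookup T f
    ... | true  = rel-refl
    ... | false = rel-refl

  sign-insert : ∀ (A : Subset n) f e → lookup A f ≡ false
              → sign (insert f A) e ≡ signPow R (sucIf (does (f <? e)) ∣ A ∩ below e ∣ₛ)
  sign-insert A f e f∉A =
    ≡.cong (signPow R) (≡.trans (∣insert∩∣ A (below e) f∉A) (≡.cong (λ b → sucIf b ∣ A ∩ below e ∣ₛ) (lookup-below e f)))

  sign-insert-< : ∀ (A : Subset n) {f e} → lookup A f ≡ false → f Fin.< e → sign (insert f A) e ≈ - sign A e
  sign-insert-< A {f} {e} f∉A f<e =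
    reflexive (≡.trans (sign-insert A f e f∉A) (≡.cong (λ b → signPow R (sucIf b ∣ A ∩ below e ∣ₛ)) (dec-true (f <? e) f<e)))

  sign-insert-≮ : ∀ (A : Subset n) {f e} → lookup A f ≡ false → ¬ (f Fin.< e) → sign (insert f A) e ≈ sign A e
  sign-insert-≮ A {f} {e} f∉A f≮e =
    reflexive (≡.trans (sign-insert A f e f∉A) (≡.cong (λ b → signPow R (sucIf b ∣ A ∩ below e ∣ₛ)) (dec-false (f <? e) f≮e)))

  -- The sign rule behind δ ∘ δ = 0: inserting f then e and inserting e then f differ by one transposition.
  sign-anticommute : ∀ (A : Subset n) f e → lookup A f ≡ false → lookup A e ≡ false → f ≢ e
                   → sign A f * sign A e ≈ - (sign (insert f A) e * sign (insert e A) f)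
  sign-anticommute A f e f∉A e∉A f≢e with Finₚ.<-cmp f e
  ... | tri≈ _ f≡e _ = ⊥-elim (f≢e f≡e)
  ... | tri< f<e _ _ = begin
    sign A f * sign A e               ≈⟨ *-comm _ _ ⟩
    sign A e * sign A f               ≈⟨ -‿involutive _ ⟨
    - - (sign A e * sign A f)         ≈⟨ -‿cong (-‿distribˡ-* _ _) ⟩
    - (- sign A e * sign A f)         ≈⟨ -‿cong (*-cong (sign-insert-< A f∉A f<e) (sign-insert-≮ A e∉A (Finₚ.<-asym f<e))) ⟨
    - (sign (insert f A) e * sign (insert e A) f) ∎
  ... | tri> _ _ e<f = begin
    sign A f * sign A e               ≈⟨ *-comm _ _ ⟩
    sign A e * sign A f               ≈⟨ -‿involutive _ ⟨
    - - (sign A e * sign A f)         ≈⟨ -‿cong (-‿distribʳ-* _ _) ⟩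
    - (sign A e * - sign A f)         ≈⟨ -‿cong (*-cong (sign-insert-≮ A f∉A (Finₚ.<-asym e<f)) (sign-insert-< A e∉A e<f)) ⟨
    - (sign (insert f A) e * sign (insert e A) f) ∎

  scale-cancel : ∀ {j S} a b (w : ⋀ j) → a ≈ - b → scale a w ++ scale b w ≈ᵂ[ S ] []
  scale-cancel a b w a≈-b = scale-+ a b w ▸ scale-cong w (trans (+-congʳ a≈-b) (-‿inverseˡ b)) ▸ scale-0 w

  scale-signPow² : ∀ {j S} k (w : ⋀ j) → scale (signPow R k) (scale (signPow R k) w) ≈ᵂ[ S ] w
  scale-signPow² k w = scale-scale _ _ w ▸ scale-cong w (signPow-square k) ▸ scale-1 w

  contract : Fin n → ∀ {j} → C j → C j
  contract e x S = if lookup S e then [] else scale (sign S e) (⋀π e (x (insert e S)))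

  contract-∈ : ∀ {j} e (x : C j) {S} → lookup S e ≡ true → contract e x S ≡ []
  contract-∈ e x e∈S rewrite e∈S = ≡.refl

  contract-∉ : ∀ {j} e (x : C j) {S} → lookup S e ≡ false → contract e x S ≡ scale (sign S e) (⋀π e (x (insert e S)))
  contract-∉ e x e∉S rewrite e∉S = ≡.refl

  contract-homotopy-∈ : ∀ {j} e (x : C j) S → lookup S e ≡ true → δ (contract e x) S ≈ᵂ[ S ] ⋀π e (x S)
  contract-homotopy-∈ e x S e∈S = ≡⇒≈ᵂ (δ-⨁ (contract e x) S) ▸ ⨁-single (piece (contract e x) S) e others ▸ at-e
    where
    others : ∀ f → f ≢ e → piece (contract e x) S f ≈ᵂ[ S ] []
    others f f≢e with lookup S f
    ... | false = rel-refl
    ... | true  = ≡⇒≈ᵂ (≡.cong (scale _) (contract-∈ e x (≡.trans (lookup-remove′ S (f≢e ∘ ≡.sym)) e∈S)))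

    at-e : piece (contract e x) S e ≈ᵂ[ S ] ⋀π e (x S)
    at-e = ≡⇒≈ᵂ (≡.trans (piece-∈ (contract e x) e∈S)
                         (≡.cong (scale _) (≡.trans (contract-∉ e x (lookup-remove e S))
                                                    (≡.cong (λ U → scale (sign (S ─ ⁅ e ⁆) e) (⋀π e (x U))) (insert-remove S e∈S)))))
           ▸ scale-signPow² ∣ (S ─ ⁅ e ⁆) ∩ below e ∣ₛ (⋀π e (x S))

  contract-homotopy-≢ : ∀ {j} e (x : C j) S f → lookup S e ≡ false → lookup S f ≡ true → f ≢ e
                      → scale (sign (S ─ ⁅ f ⁆) f) (contract e x (S ─ ⁅ f ⁆)) ++ scale (sign S e) (⋀π e (piece x (insert e S) f))
                        ≈ᵂ[ S ] []
  contract-homotopy-≢ e x S f e∉S f∈S f≢e =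
    ≡⇒≈ᵂ (≡.cong₂ _++_ first second)
    ▸ rel-++ (scale-scale (sign S∖f f) (sign S∖f e) (⋀π e (x U))) (scale-scale (sign S e) (sign U f) (⋀π e (x U)))
    ▸ scale-cancel (sign S∖f f * sign S∖f e) (sign S e * sign U f) (⋀π e (x U)) signs
    where
    S∖f : Subset n
    S∖f = S ─ ⁅ f ⁆

    U : Subset n
    U = insert e S∖f

    e∉S∖f : lookup S∖f e ≡ false
    e∉S∖f = ≡.trans (lookup-remove′ S (f≢e ∘ ≡.sym)) e∉S

    first : scale (sign S∖f f) (contract e x S∖f) ≡ scale (sign S∖f f) (scale (sign S∖f e) (⋀π e (x U)))
    first = ≡.cong (scale (sign S∖f f)) (contract-∉ e x e∉S∖f)

    second : scale (sign S e) (⋀π e (piece x (insert e S) f)) ≡ scale (sign S e) (scale (sign U f) (⋀π e (x U)))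
    second = ≡.trans (≡.cong (λ z → scale (sign S e) (⋀π e z))
                             (≡.trans (piece-∈ x (≡.trans (lookup-insert′ S f≢e) f∈S))
                                      (≡.cong (λ V → scale (sign V f) (x V)) (≡.sym (insert-remove-comm S f≢e)))))
                     (≡.cong (scale (sign S e)) (⋀π-scale e (sign U f) (x U)))

    signs : sign S∖f f * sign S∖f e ≈ - (sign S e * sign U f)
    signs = trans (sign-anticommute S∖f f e (lookup-remove f S) e∉S∖f f≢e)
                  (-‿cong (*-congʳ (reflexive (≡.cong (λ V → sign V e) (insert-remove S f∈S)))))

  contract-homotopy-∉ : ∀ {j} e (x : C j) S → lookup S e ≡ false
                      → δ (contract e x) S ++ scale (sign S e) (⋀π e (δ x (insert e S))) ≈ᵂ[ S ] ⋀π e (x S)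
  contract-homotopy-∉ {j} e x S e∉S =
    ≡⇒≈ᵂ (≡.cong₂ _++_ (δ-⨁ (contract e x) S)
                      (≡.trans (≡.cong (λ z → scale (sign S e) (⋀π e z)) (δ-⨁ x (insert e S)))
                               (≡.trans (≡.cong (scale (sign S e)) (⋀π-⨁ e (piece x (insert e S))))
                                        (scale-⨁ (sign S e) (λ f → ⋀π e (piece x (insert e S) f))))))
    ▸ rel-sym (⨁-++ A B) ▸ ⨁-single (λ f → A f ++ B f) e others ▸ at-e
    where
    A B : Fin n → ⋀ j
    A f = piece (contract e x) S f
    B f = scale (sign S e) (⋀π e (piece x (insert e S) f))

    others : ∀ f → f ≢ e → A f ++ B f ≈ᵂ[ S ] []
    others f f≢e with lookup S f in f∈?S
    ... | true  = contract-homotopy-≢ e x S f e∉S f∈?S f≢e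
    ... | false = ≡⇒≈ᵂ (≡.cong (λ z → [] ++ scale (sign S e) (⋀π e z)) (piece-∉ x (≡.trans (lookup-insert′ S f≢e) f∈?S)))

    at-e : A e ++ B e ≈ᵂ[ S ] ⋀π e (x S)
    at-e = ≡⇒≈ᵂ (≡.cong₂ _++_ (piece-∉ (contract e x) {S} {e} e∉S)
                              (≡.cong (λ z → scale (sign S e) (⋀π e z))
                                      (≡.trans (piece-∈ x (lookup-insert e S)) (≡.cong (λ U → scale (sign U e) (x U)) (remove-insert S e∉S)))))
           ▸ ≡⇒≈ᵂ (≡.cong (scale (sign S e)) (⋀π-scale e (sign S e) (x S)))
           ▸ scale-signPow² ∣ S ∩ below e ∣ₛ (⋀π e (x S))

  contract-homotopy : ∀ {j} e (x : C j) S → δ (contract e x) S ++ contract e (δ x) S ≈ᵂ[ S ] ⋀π e (x S)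
  contract-homotopy e x S with lookup S e in e∈?S
  ... | true  = ++-identityʳ _ ▸ contract-homotopy-∈ e x S e∈?S
  ... | false = contract-homotopy-∉ e x S e∈?S

  Hᴸ : List (Fin n) → ∀ {j} → C j → C j
  Hᴸ []      x S = []
  Hᴸ (e ∷ L) x S = contract e x S ++ P e (Hᴸ L x S)

  absorb-negate : ∀ {j S} (q x y : ⋀ j) → q ++ ((x ++ negate q) ++ y) ≈ᵂ[ S ] x ++ y
  absorb-negate q x y =
    rel-sym (++-assoc q (x ++ negate q) y)
    ▸ ++-congʳ y (rel-sym (++-assoc q x (negate q)) ▸ ++-congʳ (negate q) (rel-comm q x)
                  ▸ ++-assoc x q (negate q) ▸ ++-congˡ x (++-inverseʳ q) ▸ ++-identityʳ x)

  homotopy-identity : ∀ {j} L (x : C j) S → δ (Hᴸ L x) S ++ Hᴸ L (δ x) S ≈ᵂ[ S ] x S ++ negate (Pᴸ L (x S))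
  homotopy-identity []      x S = ++-identityʳ (δ (Hᴸ [] x) S) ▸ δ-[] S ▸ rel-sym (++-inverseʳ (x S))
  homotopy-identity (e ∷ L) x S =
    ++-congʳ (Hᴸ (e ∷ L) (δ x) S) (δ-++ (contract e x) (λ U → P e (Hᴸ L x U)) S ▸ ++-congˡ _ (δ-P e (Hᴸ L x) S))
    ▸ ++-interchange (δ (contract e x) S) (P e (δ (Hᴸ L x) S)) (contract e (δ x) S) (P e (Hᴸ L (δ x) S))
    ▸ rel-++ (contract-homotopy e x S)
             (rel-sym (P-++ e (δ (Hᴸ L x) S) (Hᴸ L (δ x) S)) ▸ P-cong (homotopy-identity L x S) ▸ P-++ e (x S) (negate (Pᴸ L (x S))))
    ▸ ++-congˡ (⋀π e (x S)) (++-congˡ (P e (x S)) (P-scale e (- 1#) (Pᴸ L (x S))))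
    ▸ absorb-negate (⋀π e (x S)) (x S) (negate (Pᴸ (e ∷ L) (x S)))

  Hᴸ-cong : ∀ {j} L {x x′ : C j} {i} → x ≈ᶜ[ ℕ.suc i ] x′ → Hᴸ L x ≈ᶜ[ i ] Hᴸ L x′
  Hᴸ-cong []      x≈x′ S ∣S∣≡i = rel-refl
  Hᴸ-cong (e ∷ L) {x} {x′} x≈x′ S ∣S∣≡i = rel-++ contract-cong (P-cong (Hᴸ-cong L x≈x′ S ∣S∣≡i))
    where
    contract-cong : contract e x S ≈ᵂ[ S ] contract e x′ S
    contract-cong with lookup S e in e∈?S
    ... | true  = rel-refl
    ... | false = rel-· _ (⋀π-cong-insert (x≈x′ (insert e S) (≡.trans (∣insert∣ S e∈?S) (≡.cong ℕ.suc ∣S∣≡i))))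

  Hᴸ-[] : ∀ {j} L S → Hᴸ L {j} (λ _ → []) S ≈ᵂ[ S ] []
  Hᴸ-[]     []      S = rel-refl
  Hᴸ-[] {j} (e ∷ L) S = rel-++ contract-[] (P-cong (Hᴸ-[] L S))
    where
    contract-[] : contract e {j} (λ _ → []) S ≈ᵂ[ S ] []
    contract-[] with lookup S e
    ... | true  = rel-refl
    ... | false = rel-refl

  π-unit-≢ : ∀ {e f} → f ≢ e → π e (unit f) ≈ᴺ unit f
  π-unit-≢ {e} {f} f≢e g with g Finₚ.≟ e
  ... | yes ≡.refl = sym (unit-other (f≢e ∘ ≡.sym))
  ... | no  _      = refl

  π-unit-≡ : ∀ e → π e (unit e) ≈ᴺ 0ᴺ
  π-unit-≡ e g with g Finₚ.≟ e
  ... | yes _ = refl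
  ... | no  _ = refl

  lookup-⋀π-basis : ∀ {j} e (σ : Vec (Fin n) j) k → lookup (Vec.map (π e) (Vec.map unit σ)) k ≡ π e (unit (lookup σ k))
  lookup-⋀π-basis e σ k = ≡.trans (Vecₚ.lookup-map k (π e) (Vec.map unit σ)) (≡.cong (π e) (lookup-map-unit σ k))

  P-missing : ∀ {j S e} b (σ : Vec (Fin n) j) → (∀ k → lookup σ k ≢ e) → P e ((b , Vec.map unit σ) ∷ []) ≈ᵂ[ S ] []
  P-missing {S = S} {e} b σ e∉σ = ++-congˡ ((b , Vec.map unit σ) ∷ []) (rel-· (- 1#) ⋀π≈id′) ▸ ++-inverseʳ ((b , Vec.map unit σ) ∷ [])
    where
    ⋀π≈id′ : ⋀π e ((b , Vec.map unit σ) ∷ []) ≈ᵂ[ S ] (b , Vec.map unit σ) ∷ []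
    ⋀π≈id′ = entrywise-cong b _ _ λ k → ≈ᴺ⇒≈ᴺ[S] λ g →
      trans (reflexive (≡.cong (λ z → z g) (lookup-⋀π-basis e σ k)))
            (trans (π-unit-≢ (e∉σ k) g) (reflexive (≡.cong (λ z → z g) (≡.sym (lookup-map-unit σ k)))))

  P-hit : ∀ {j S e} b (σ : Vec (Fin n) j) k → lookup σ k ≡ e → P e ((b , Vec.map unit σ) ∷ []) ≈ᵂ[ S ] (b , Vec.map unit σ) ∷ []
  P-hit {S = S} {e} b σ k σₖ≡e = ++-congˡ ((b , Vec.map unit σ) ∷ []) (rel-· (- 1#) ⋀π≈[]) ▸ ++-identityʳ ((b , Vec.map unit σ) ∷ [])
    where
    ⋀π≈[] : ⋀π e ((b , Vec.map unit σ) ∷ []) ≈ᵂ[ S ] []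
    ⋀π≈[] = zero-entry′ b _ k λ g →
      trans (reflexive (≡.cong (λ z → z g) (≡.trans (lookup-⋀π-basis e σ k) (≡.cong (π e ∘ unit) σₖ≡e)))) (π-unit-≡ e g)

  Pᴸ-basis-dichotomy : ∀ {j S} L b (σ : Vec (Fin n) j)
                     → Pᴸ L ((b , Vec.map unit σ) ∷ []) ≈ᵂ[ S ] (b , Vec.map unit σ) ∷ []
                     ⊎ Pᴸ L ((b , Vec.map unit σ) ∷ []) ≈ᵂ[ S ] []
  Pᴸ-basis-dichotomy []      b σ = inj₁ rel-refl
  Pᴸ-basis-dichotomy (e ∷ L) b σ with Pᴸ-basis-dichotomy L b σ
  ... | inj₂ Pᴸ≈[]   = inj₂ (P-cong Pᴸ≈[])
  ... | inj₁ Pᴸ≈term with Finₚ.any? (λ k → lookup σ k Finₚ.≟ e)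
  ...   | yes (k , σₖ≡e) = inj₁ (P-cong Pᴸ≈term ▸ P-hit b σ k σₖ≡e)
  ...   | no  e∉σ        = inj₂ (P-cong Pᴸ≈term ▸ P-missing b σ (λ k σₖ≡e → e∉σ (k , σₖ≡e)))

  Pᴸ-missing : ∀ {j S e L} b (σ : Vec (Fin n) j) → e ∈ₗ L → (∀ k → lookup σ k ≢ e)
             → Pᴸ L ((b , Vec.map unit σ) ∷ []) ≈ᵂ[ S ] []
  Pᴸ-missing {L = e ∷ L} b σ (here ≡.refl) e∉σ with Pᴸ-basis-dichotomy L b σ
  ... | inj₁ Pᴸ≈term = P-cong Pᴸ≈term ▸ P-missing b σ e∉σ
  ... | inj₂ Pᴸ≈[]   = P-cong Pᴸ≈[]
  Pᴸ-missing {L = _ ∷ L} b σ (there e∈L) e∉σ = P-cong (Pᴸ-missing b σ e∈L e∉σ)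

  Pᴬˡˡ : ∀ {j} → ⋀ j → ⋀ j
  Pᴬˡˡ = Pᴸ (List.allFin n)

  -- A basis wedge of degree j ≠ n either misses a coordinate, which its projector kills, or repeats one.
  Pᴬˡˡ-basisWedge : ∀ {j S} → j ≢ n → (L : List (BasisTerm j)) → Pᴬˡˡ (basisWedge L) ≈ᵂ[ S ] []
  Pᴬˡˡ-basisWedge j≢n []            = ≡⇒≈ᵂ (Pᴸ-[] (List.allFin n))
  Pᴬˡˡ-basisWedge j≢n ((b , σ) ∷ L) =
    Pᴸ-++ (List.allFin n) ((b , Vec.map unit σ) ∷ []) (basisWedge L) ▸ rel-++ single (Pᴬˡˡ-basisWedge j≢n L)
    where
    single : Pᴬˡˡ ((b , Vec.map unit σ) ∷ []) ≈ᵂ[ _ ] []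
    single with missing-or-repeated j≢n σ
    ... | inj₁ (e , e∉σ)               = Pᴸ-missing b σ (∈-allFin e) e∉σ
    ... | inj₂ (i , k , i≢k , σᵢ≡σₖ) =
      Pᴸ-cong (List.allFin n) (repeated-index⇒≈[] b σ i≢k σᵢ≡σₖ) ▸ ≡⇒≈ᵂ (Pᴸ-[] (List.allFin n))

  Pᴬˡˡ-vanish : ∀ {j S} → j ≢ n → (w : ⋀ j) → Pᴬˡˡ w ≈ᵂ[ S ] []
  Pᴬˡˡ-vanish j≢n w with expand w
  ... | L , w≈L = Pᴸ-cong (List.allFin n) w≈L ▸ Pᴬˡˡ-basisWedge j≢n L

-- Rows of a matrix are indexed by ℕ rather than Fin k, so that the adjacent rows p and suc p of the
-- alternation argument need no casts; punchInℕ l is the ℕ analogue of Fin.punchIn.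
module RowIndexFacts where

  punchInℕ : ℕ → ℕ → ℕ
  punchInℕ l r = if does (r ℕ.<? l) then r else ℕ.suc r

  punchInℕ-< : ∀ {l r} → r < l → punchInℕ l r ≡ r
  punchInℕ-< {l} {r} r<l rewrite dec-true (r ℕ.<? l) r<l = ≡.refl

  punchInℕ-≮ : ∀ {l r} → ¬ (r < l) → punchInℕ l r ≡ ℕ.suc r
  punchInℕ-≮ {l} {r} r≮l rewrite dec-false (r ℕ.<? l) r≮l = ≡.refl

  punchInℕ≢ : ∀ l r → punchInℕ l r ≢ l
  punchInℕ≢ l r eq with r ℕ.<? l
  ... | yes r<l = ℕₚ.<⇒≢ r<l (≡.trans (≡.sym (punchInℕ-< r<l)) eq)
  ... | no  r≮l = r≮l (ℕₚ.≤-reflexive (≡.trans (≡.sym (punchInℕ-≮ r≮l)) eq))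

  punchInℕ-injective : ∀ l {r r′} → punchInℕ l r ≡ punchInℕ l r′ → r ≡ r′
  punchInℕ-injective l {r} {r′} eq with r ℕ.<? l | r′ ℕ.<? l
  ... | yes r<l | yes r′<l = ≡.trans (≡.sym (punchInℕ-< r<l)) (≡.trans eq (punchInℕ-< r′<l))
  ... | no  r≮l | no  r′≮l = ℕₚ.suc-injective (≡.trans (≡.sym (punchInℕ-≮ r≮l)) (≡.trans eq (punchInℕ-≮ r′≮l)))
  ... | yes r<l | no  r′≮l =
    ⊥-elim (r′≮l (ℕₚ.<-trans (ℕₚ.n<1+n r′) (≡.subst (_< l) (≡.trans (≡.sym (punchInℕ-< r<l)) (≡.trans eq (punchInℕ-≮ r′≮l))) r<l)))
  ... | no  r≮l | yes r′<l =
    ⊥-elim (r≮l (ℕₚ.<-trans (ℕₚ.n<1+n r) (≡.subst (_< l) (≡.trans (≡.sym (punchInℕ-< r′<l)) (≡.trans (≡.sym eq) (punchInℕ-≮ r≮l))) r′<l)))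

  punchOutℕ : ℕ → ℕ → ℕ
  punchOutℕ l i = if does (i ℕ.<? l) then i else pred i

  punchOutℕ-< : ∀ {l i} → i < l → punchOutℕ l i ≡ i
  punchOutℕ-< {l} {i} i<l rewrite dec-true (i ℕ.<? l) i<l = ≡.refl

  punchOutℕ-≮ : ∀ {l i} → ¬ (i < l) → punchOutℕ l i ≡ pred i
  punchOutℕ-≮ {l} {i} i≮l rewrite dec-false (i ℕ.<? l) i≮l = ≡.refl

  punchInℕ-punchOutℕ : ∀ {l i} → i ≢ l → punchInℕ l (punchOutℕ l i) ≡ i
  punchInℕ-punchOutℕ {l} {i} i≢l with i ℕ.<? l
  ... | yes i<l = ≡.trans (≡.cong (punchInℕ l) (punchOutℕ-< i<l)) (punchInℕ-< i<l)
  punchInℕ-punchOutℕ {l} {ℕ.zero}  i≢l | no i≮l = ⊥-elim (i≮l (ℕₚ.≤∧≢⇒< z≤n i≢l))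
  punchInℕ-punchOutℕ {l} {ℕ.suc i} i≢l | no i≮l =
    ≡.trans (≡.cong (punchInℕ l) (punchOutℕ-≮ i≮l)) (punchInℕ-≮ (λ i<l → i≮l (ℕₚ.≤∧≢⇒< i<l i≢l)))

  punchOutℕ-bound : ∀ {k l i} → i < ℕ.suc k → l < ℕ.suc k → i ≢ l → punchOutℕ l i < k
  punchOutℕ-bound {k} {l} {i} i<1+k l<1+k i≢l with i ℕ.<? l
  ... | yes i<l = ≡.subst (_< k) (≡.sym (punchOutℕ-< i<l)) (ℕₚ.<-≤-trans i<l (ℕₚ.≤-pred l<1+k))
  punchOutℕ-bound {k} {l} {ℕ.zero}  i<1+k l<1+k i≢l | no i≮l = ⊥-elim (i≮l (ℕₚ.≤∧≢⇒< z≤n i≢l))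
  punchOutℕ-bound {k} {l} {ℕ.suc i} i<1+k l<1+k i≢l | no i≮l = ≡.subst (_< k) (≡.sym (punchOutℕ-≮ i≮l)) (ℕₚ.≤-pred i<1+k)

  adjacent-punchInℕ : ∀ {k l p} → l < ℕ.suc k → ℕ.suc p < ℕ.suc k → l ≢ p → l ≢ ℕ.suc p
                    → ∃ λ p′ → ℕ.suc p′ < k × punchInℕ l p′ ≡ p × punchInℕ l (ℕ.suc p′) ≡ ℕ.suc p
  adjacent-punchInℕ {k} {l} {p} l<1+k 1+p<1+k l≢p l≢1+p with l ℕ.<? p
  adjacent-punchInℕ {k} {l} {ℕ.suc p′} l<1+k 1+p<1+k l≢p l≢1+p | yes l<p =
    p′ , ℕₚ.≤-pred 1+p<1+k , punchInℕ-≮ (ℕₚ.≤⇒≯ (ℕₚ.≤-pred l<p)) , punchInℕ-≮ (ℕₚ.≤⇒≯ (ℕₚ.m≤n⇒m≤1+n (ℕₚ.≤-pred l<p)))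
  ... | no l≮p = p , ℕₚ.<-≤-trans 1+p<l (ℕₚ.≤-pred l<1+k) , punchInℕ-< (ℕₚ.<-trans (ℕₚ.n<1+n p) 1+p<l) , punchInℕ-< 1+p<l
    where
    1+p<l : ℕ.suc p < l
    1+p<l = ℕₚ.≤∧≢⇒< (ℕₚ.≤∧≢⇒< (ℕₚ.≮⇒≥ l≮p) (l≢p ∘ ≡.sym)) (l≢1+p ∘ ≡.sym)

  setRows : ∀ {a} {A : Set a} → ℕ → A → A → (ℕ → A) → ℕ → A
  setRows p x y F r = if does (r ℕ.≟ p) then x else (if does (r ℕ.≟ ℕ.suc p) then y else F r)

  setRows-first : ∀ {a} {A : Set a} p (x y : A) F → setRows p x y F p ≡ x
  setRows-first p x y F rewrite dec-true (p ℕ.≟ p) ≡.refl = ≡.refl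

  setRows-second : ∀ {a} {A : Set a} p (x y : A) F → setRows p x y F (ℕ.suc p) ≡ y
  setRows-second p x y F rewrite dec-false (ℕ.suc p ℕ.≟ p) (ℕₚ.1+n≢n) | dec-true (ℕ.suc p ℕ.≟ ℕ.suc p) ≡.refl = ≡.refl

  setRows-other : ∀ {a} {A : Set a} p (x y : A) F r → r ≢ p → r ≢ ℕ.suc p → setRows p x y F r ≡ F r
  setRows-other p x y F r r≢p r≢1+p rewrite dec-false (r ℕ.≟ p) r≢p | dec-false (r ℕ.≟ ℕ.suc p) r≢1+p = ≡.refl

  setRows-irrelevant-first : ∀ {a} {A : Set a} p (x x′ y : A) F r → r ≢ p → setRows p x y F r ≡ setRows p x′ y F r
  setRows-irrelevant-first p x x′ y F r r≢p rewrite dec-false (r ℕ.≟ p) r≢p = ≡.refl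

  setRows-irrelevant-second : ∀ {a} {A : Set a} p (x y y′ : A) F r → r ≢ ℕ.suc p → setRows p x y F r ≡ setRows p x y′ F r
  setRows-irrelevant-second p x y y′ F r r≢1+p with r ℕ.≟ p
  ... | yes r≡p rewrite dec-true (r ℕ.≟ p) r≡p = ≡.refl
  ... | no  r≢p rewrite dec-false (r ℕ.≟ p) r≢p | dec-false (r ℕ.≟ ℕ.suc p) r≢1+p = ≡.refl

  setRows-id : ∀ {a} {A : Set a} p (F : ℕ → A) r → setRows p (F p) (F (ℕ.suc p)) F r ≡ F r
  setRows-id p F r with r ℕ.≟ p
  ... | yes r≡p rewrite dec-true (r ℕ.≟ p) r≡p = ≡.cong F (≡.sym r≡p)
  ... | no  r≢p with r ℕ.≟ ℕ.suc p
  ...   | yes r≡1+p rewrite dec-false (r ℕ.≟ p) r≢p | dec-true (r ℕ.≟ ℕ.suc p) r≡1+p = ≡.cong F (≡.sym r≡1+p)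
  ...   | no  r≢1+p rewrite dec-false (r ℕ.≟ p) r≢p | dec-false (r ℕ.≟ ℕ.suc p) r≢1+p = ≡.refl

  lookupℕ : ∀ {a} {A : Set a} {k} → A → Vec A k → ℕ → A
  lookupℕ default []      r         = default
  lookupℕ default (x ∷ v) ℕ.zero    = x
  lookupℕ default (x ∷ v) (ℕ.suc r) = lookupℕ default v r

  lookupℕ-update : ∀ {a} {A : Set a} {k} default (v : Vec A k) i x → lookupℕ default (v [ i ]≔ x) (toℕ i) ≡ x
  lookupℕ-update default (y ∷ v) zero    x = ≡.refl
  lookupℕ-update default (y ∷ v) (suc i) x = lookupℕ-update default v i x

  lookupℕ-update′ : ∀ {a} {A : Set a} {k} default (v : Vec A k) i x r → r ≢ toℕ i
                  → lookupℕ default (v [ i ]≔ x) r ≡ lookupℕ default v r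
  lookupℕ-update′ default (y ∷ v) zero    x ℕ.zero    r≢i = ⊥-elim (r≢i ≡.refl)
  lookupℕ-update′ default (y ∷ v) zero    x (ℕ.suc r) r≢i = ≡.refl
  lookupℕ-update′ default (y ∷ v) (suc i) x ℕ.zero    r≢i = ≡.refl
  lookupℕ-update′ default (y ∷ v) (suc i) x (ℕ.suc r) r≢i = lookupℕ-update′ default v i x r (r≢i ∘ ≡.cong ℕ.suc)

open RowIndexFacts

module Determinant {c ℓ : Level} (R : CommutativeRing c ℓ) (n : ℕ) where
  open RingFacts R

  Row : Set c
  Row = Fin n → Carrier

  infix 4 _≈ʳ_

  _≈ʳ_ : Row → Row → Set ℓ
  x ≈ʳ y = ∀ e → x e ≈ y e

  Σℕ : ℕ → (ℕ → Carrier) → Carrier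
  Σℕ ℕ.zero    h = 0#
  Σℕ (ℕ.suc K) h = h 0 + Σℕ K (λ l → h (ℕ.suc l))

  Σℕ-cong : ∀ K {h h′ : ℕ → Carrier} → (∀ l → l < K → h l ≈ h′ l) → Σℕ K h ≈ Σℕ K h′
  Σℕ-cong ℕ.zero    h≈h′ = refl
  Σℕ-cong (ℕ.suc K) h≈h′ = +-cong (h≈h′ 0 (s≤s z≤n)) (Σℕ-cong K (λ l l<K → h≈h′ (ℕ.suc l) (s≤s l<K)))

  Σℕ-+ : ∀ K (h h′ : ℕ → Carrier) → Σℕ K (λ l → h l + h′ l) ≈ Σℕ K h + Σℕ K h′
  Σℕ-+ ℕ.zero    h h′ = sym (+-identityʳ 0#)
  Σℕ-+ (ℕ.suc K) h h′ = trans (+-congˡ (Σℕ-+ K (λ l → h (ℕ.suc l)) (λ l → h′ (ℕ.suc l)))) (+-interchange _ _ _ _)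

  Σℕ-*ˡ : ∀ K b h → Σℕ K (λ l → b * h l) ≈ b * Σℕ K h
  Σℕ-*ˡ ℕ.zero    b h = sym (zeroʳ b)
  Σℕ-*ˡ (ℕ.suc K) b h = trans (+-congˡ (Σℕ-*ˡ K b (λ l → h (ℕ.suc l)))) (sym (distribˡ _ _ _))

  Σℕ-zero : ∀ K {h : ℕ → Carrier} → (∀ l → l < K → h l ≈ 0#) → Σℕ K h ≈ 0#
  Σℕ-zero ℕ.zero    h≈0 = refl
  Σℕ-zero (ℕ.suc K) h≈0 = trans (+-cong (h≈0 0 (s≤s z≤n)) (Σℕ-zero K (λ l l<K → h≈0 (ℕ.suc l) (s≤s l<K)))) (+-identityʳ 0#)

  Σℕ-first : ∀ K {h : ℕ → Carrier} → (∀ l → l < K → h (ℕ.suc l) ≈ 0#) → Σℕ (ℕ.suc K) h ≈ h 0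
  Σℕ-first K rest≈0 = trans (+-congˡ (Σℕ-zero K rest≈0)) (+-identityʳ _)

  Σℕ-pair : ∀ K p {h : ℕ → Carrier} → ℕ.suc p < K → (∀ l → l < K → l ≢ p → l ≢ ℕ.suc p → h l ≈ 0#)
          → h p + h (ℕ.suc p) ≈ 0# → Σℕ K h ≈ 0#
  Σℕ-pair (ℕ.suc (ℕ.suc K)) ℕ.zero {h} _ others≈0 pair≈0 =
    trans (sym (+-assoc _ _ _))
          (trans (+-congˡ (Σℕ-zero K (λ l l<K → others≈0 (ℕ.suc (ℕ.suc l)) (s≤s (s≤s l<K)) (λ ()) (λ ())))) (trans (+-identityʳ _) pair≈0))
  Σℕ-pair (ℕ.suc K) (ℕ.suc p) {h} (s≤s 1+p<K) others≈0 pair≈0 =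
    trans (+-cong (others≈0 0 (s≤s z≤n) (λ ()) (λ ()))
                  (Σℕ-pair K p {λ l → h (ℕ.suc l)} 1+p<K
                     (λ l l<K l≢p l≢1+p → others≈0 (ℕ.suc l) (s≤s l<K) (l≢p ∘ ℕₚ.suc-injective) (l≢1+p ∘ ℕₚ.suc-injective)) pair≈0))
          (+-identityʳ 0#)

  minor : (ℕ → Row) → ℕ → ℕ → Row
  minor F l r = F (punchInℕ l r)

  -- det τ F is the determinant of the matrix with rows F 0, F 1, … and columns τ, expanded along the
  -- first column.
  det : ∀ {k} → Vec (Fin n) k → (ℕ → Row) → Carrier
  det []                    F = 1#
  det {ℕ.suc k} (t ∷ τ) F = Σℕ (ℕ.suc k) (λ l → signPow R l * (F l t * det τ (minor F l)))

  det-cong : ∀ {k} (τ : Vec (Fin n) k) {F G : ℕ → Row} → (∀ r → F r ≈ʳ G r) → det τ F ≈ det τ G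
  det-cong []                F≈G = refl
  det-cong {ℕ.suc k} (t ∷ τ) F≈G =
    Σℕ-cong (ℕ.suc k) (λ l _ → *-congˡ {signPow R l} (*-cong (F≈G l t) (det-cong τ (λ r → F≈G (punchInℕ l r)))))

  module _ {k} (i l : ℕ) (i<1+k : i < ℕ.suc k) (l<1+k : l < ℕ.suc k) (l≢i : l ≢ i) where

    minor-row : punchInℕ l (punchOutℕ l i) ≡ i
    minor-row = punchInℕ-punchOutℕ (l≢i ∘ ≡.sym)

    minor-row-bound : punchOutℕ l i < k
    minor-row-bound = punchOutℕ-bound i<1+k l<1+k (l≢i ∘ ≡.sym)

    minor-other-rows : ∀ {F G : ℕ → Row} → (∀ r → r ≢ i → F r ≈ʳ G r)
                     → ∀ r → r ≢ punchOutℕ l i → minor F l r ≈ʳ minor G l r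
    minor-other-rows F≈G r r≢i′ = F≈G (punchInℕ l r) (λ eq → r≢i′ (punchInℕ-injective l (≡.trans eq (≡.sym minor-row))))

  det-linear-+ : ∀ {k} (τ : Vec (Fin n) k) {F G H : ℕ → Row} i → i < k → (∀ e → F i e ≈ G i e + H i e)
               → (∀ r → r ≢ i → F r ≈ʳ G r) → (∀ r → r ≢ i → F r ≈ʳ H r) → det τ F ≈ det τ G + det τ H
  det-linear-+ []                i () _ _ _
  det-linear-+ {ℕ.suc k} (t ∷ τ) {F} {G} {H} i i<1+k Fᵢ≈Gᵢ+Hᵢ F≈G F≈H =
    trans (Σℕ-cong (ℕ.suc k) summand) (Σℕ-+ (ℕ.suc k) (expansion G) (expansion H))
    where
    expansion : (ℕ → Row) → ℕ → Carrier
    expansion K l = signPow R l * (K l t * det τ (minor K l))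

    summand : ∀ l → l < ℕ.suc k → expansion F l ≈ expansion G l + expansion H l
    summand l l<1+k with l ℕ.≟ i
    ... | yes ≡.refl = begin
      signPow R l * (F l t * det τ (minor F l))
        ≈⟨ *-congˡ (*-cong (Fᵢ≈Gᵢ+Hᵢ t) (det-cong τ (λ r → F≈G (punchInℕ l r) (punchInℕ≢ l r)))) ⟩
      signPow R l * ((G l t + H l t) * det τ (minor G l))
        ≈⟨ trans (*-congˡ (distribʳ _ _ _)) (distribˡ _ _ _) ⟩
      signPow R l * (G l t * det τ (minor G l)) + signPow R l * (H l t * det τ (minor G l))
        ≈⟨ +-congˡ (*-congˡ (*-congˡ (det-cong τ λ r e →
             trans (sym (F≈G (punchInℕ l r) (punchInℕ≢ l r) e)) (F≈H (punchInℕ l r) (punchInℕ≢ l r) e)))) ⟩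
      signPow R l * (G l t * det τ (minor G l)) + signPow R l * (H l t * det τ (minor H l)) ∎
    ... | no l≢i = begin
      signPow R l * (F l t * det τ (minor F l))
        ≈⟨ *-congˡ (*-congˡ minor-linear) ⟩
      signPow R l * (F l t * (det τ (minor G l) + det τ (minor H l)))
        ≈⟨ trans (*-congˡ (distribˡ _ _ _)) (distribˡ _ _ _) ⟩
      signPow R l * (F l t * det τ (minor G l)) + signPow R l * (F l t * det τ (minor H l))
        ≈⟨ +-cong (*-congˡ (*-congʳ (F≈G l l≢i t))) (*-congˡ (*-congʳ (F≈H l l≢i t))) ⟩
      signPow R l * (G l t * det τ (minor G l)) + signPow R l * (H l t * det τ (minor H l)) ∎
      where
      minor-linear : det τ (minor F l) ≈ det τ (minor G l) + det τ (minor H l)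
      minor-linear = det-linear-+ τ (punchOutℕ l i) (minor-row-bound i l i<1+k l<1+k l≢i)
                       (λ e → ≡.subst (λ r → F r e ≈ G r e + H r e) (≡.sym (minor-row i l i<1+k l<1+k l≢i)) (Fᵢ≈Gᵢ+Hᵢ e))
                       (minor-other-rows i l i<1+k l<1+k l≢i F≈G) (minor-other-rows i l i<1+k l<1+k l≢i F≈H)

  det-linear-· : ∀ {k} (τ : Vec (Fin n) k) {F G : ℕ → Row} i b → i < k → (∀ e → F i e ≈ b * G i e)
               → (∀ r → r ≢ i → F r ≈ʳ G r) → det τ F ≈ b * det τ G
  det-linear-· []                i b () _ _
  det-linear-· {ℕ.suc k} (t ∷ τ) {F} {G} i b i<1+k Fᵢ≈bGᵢ F≈G =
    trans (Σℕ-cong (ℕ.suc k) summand) (Σℕ-*ˡ (ℕ.suc k) b (expansion G))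
    where
    expansion : (ℕ → Row) → ℕ → Carrier
    expansion K l = signPow R l * (K l t * det τ (minor K l))

    open CommutativeSemigroupProperties *-commutativeSemigroup using (x∙yz≈y∙xz)

    summand : ∀ l → l < ℕ.suc k → expansion F l ≈ b * expansion G l
    summand l l<1+k with l ℕ.≟ i
    ... | yes ≡.refl = begin
      signPow R l * (F l t * det τ (minor F l))
        ≈⟨ *-congˡ (*-cong (Fᵢ≈bGᵢ t) (det-cong τ (λ r → F≈G (punchInℕ l r) (punchInℕ≢ l r)))) ⟩
      signPow R l * ((b * G l t) * det τ (minor G l))
        ≈⟨ *-congˡ (*-assoc _ _ _) ⟩
      signPow R l * (b * (G l t * det τ (minor G l)))
        ≈⟨ x∙yz≈y∙xz _ _ _ ⟩
      b * (signPow R l * (G l t * det τ (minor G l))) ∎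
    ... | no l≢i = begin
      signPow R l * (F l t * det τ (minor F l))
        ≈⟨ *-congˡ (*-cong (F≈G l l≢i t) minor-linear) ⟩
      signPow R l * (G l t * (b * det τ (minor G l)))
        ≈⟨ *-congˡ (x∙yz≈y∙xz _ _ _) ⟩
      signPow R l * (b * (G l t * det τ (minor G l)))
        ≈⟨ x∙yz≈y∙xz _ _ _ ⟩
      b * (signPow R l * (G l t * det τ (minor G l))) ∎
      where
      minor-linear : det τ (minor F l) ≈ b * det τ (minor G l)
      minor-linear = det-linear-· τ (punchOutℕ l i) b (minor-row-bound i l i<1+k l<1+k l≢i)
                       (λ e → ≡.subst (λ r → F r e ≈ b * G r e) (≡.sym (minor-row i l i<1+k l<1+k l≢i)) (Fᵢ≈bGᵢ e))
                       (minor-other-rows i l i<1+k l<1+k l≢i F≈G)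

  minors-of-adjacent-rows : ∀ (F : ℕ → Row) p → F p ≈ʳ F (ℕ.suc p) → ∀ r → minor F p r ≈ʳ minor F (ℕ.suc p) r
  minors-of-adjacent-rows F p Fₚ≈Fₚ₊₁ r e with ℕₚ.<-cmp r p
  ... | tri< r<p _ _ =
    reflexive (≡.cong (λ z → F z e) (≡.trans (punchInℕ-< r<p) (≡.sym (punchInℕ-< (ℕₚ.<-trans r<p (ℕₚ.n<1+n p))))))
  ... | tri≈ _ ≡.refl _ =
    trans (reflexive (≡.cong (λ z → F z e) (punchInℕ-≮ (ℕₚ.<-irrefl ≡.refl))))
          (trans (sym (Fₚ≈Fₚ₊₁ e)) (reflexive (≡.cong (λ z → F z e) (≡.sym (punchInℕ-< (ℕₚ.n<1+n r))))))
  ... | tri> _ _ p<r =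
    reflexive (≡.cong (λ z → F z e) (≡.trans (punchInℕ-≮ (λ r<p → ℕₚ.<-asym r<p p<r)) (≡.sym (punchInℕ-≮ (ℕₚ.<⇒≱ p<r ∘ ℕₚ.≤-pred)))))

  -- In the expansion along the first column, the two summands of rows p and p+1 cancel, and every
  -- other minor still has two equal adjacent rows.
  det-adjacent : ∀ {k} (τ : Vec (Fin n) k) (F : ℕ → Row) p → ℕ.suc p < k → F p ≈ʳ F (ℕ.suc p) → det τ F ≈ 0#
  det-adjacent []                F p () _
  det-adjacent {ℕ.suc k} (t ∷ τ) F p 1+p<1+k Fₚ≈Fₚ₊₁ = Σℕ-pair (ℕ.suc k) p 1+p<1+k others pair
    where
    expansion : ℕ → Carrier
    expansion l = signPow R l * (F l t * det τ (minor F l))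

    others : ∀ l → l < ℕ.suc k → l ≢ p → l ≢ ℕ.suc p → expansion l ≈ 0#
    others l l<1+k l≢p l≢1+p with adjacent-punchInℕ l<1+k 1+p<1+k l≢p l≢1+p
    ... | p′ , 1+p′<k , row-p′ , row-1+p′ =
      trans (*-congˡ (trans (*-congˡ minor≈0) (zeroʳ _))) (zeroʳ _)
      where
      minor≈0 : det τ (minor F l) ≈ 0#
      minor≈0 = det-adjacent τ (minor F l) p′ 1+p′<k
                  (λ e → ≡.subst₂ (λ u v → F u e ≈ F v e) (≡.sym row-p′) (≡.sym row-1+p′) (Fₚ≈Fₚ₊₁ e))

    pair : expansion p + expansion (ℕ.suc p) ≈ 0#
    pair = begin
      signPow R p * (F p t * det τ (minor F p)) + - signPow R p * X
        ≈⟨ +-congʳ (*-congˡ (*-cong (Fₚ≈Fₚ₊₁ t) (det-cong τ (minors-of-adjacent-rows F p Fₚ≈Fₚ₊₁)))) ⟩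
      signPow R p * X + - signPow R p * X   ≈⟨ distribʳ X _ _ ⟨
      (signPow R p + - signPow R p) * X     ≈⟨ *-congʳ (-‿inverseʳ _) ⟩
      0# * X                                ≈⟨ zeroˡ X ⟩
      0#                                    ∎
      where
      X : Carrier
      X = F (ℕ.suc p) t * det τ (minor F (ℕ.suc p))

  det-swap : ∀ {k} (τ : Vec (Fin n) k) (F : ℕ → Row) p → ℕ.suc p < k → det τ (setRows p (F (ℕ.suc p)) (F p) F) ≈ - det τ F
  det-swap τ F p 1+p<k = +-inverseˡ-unique _ _ (begin
    det τ (rows y x) + det τ F                               ≈⟨ +-comm _ _ ⟩
    det τ F + det τ (rows y x)                               ≈⟨ +-cong (+-identityˡ _) (+-identityʳ _) ⟨
    (0# + det τ F) + (det τ (rows y x) + 0#)                 ≈⟨ +-cong (+-congʳ (adjacent x)) (+-congˡ (adjacent y)) ⟨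
    (det τ (rows x x) + det τ F) + (det τ (rows y x) + det τ (rows y y))
      ≈⟨ +-cong (trans (second-linear x) (+-congˡ (det-cong τ (λ r → reflexive ∘ ≡.cong-app (setRows-id p F r))))) (second-linear y) ⟨
    det τ (rows x s) + det τ (rows y s)                      ≈⟨ first-linear s ⟨
    det τ (rows s s)                                         ≈⟨ adjacent s ⟩
    0#                                                       ∎)
    where
    x y s : Row
    x = F p
    y = F (ℕ.suc p)
    s e = x e + y e

    rows : Row → Row → ℕ → Row
    rows u v = setRows p u v F

    adjacent : ∀ u → det τ (rows u u) ≈ 0#
    adjacent u = det-adjacent τ (rows u u) p 1+p<k
                   (λ e → reflexive (≡.trans (≡.cong-app (setRows-first p u u F) e) (≡.sym (≡.cong-app (setRows-second p u u F) e))))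

    first-linear : ∀ v → det τ (rows s v) ≈ det τ (rows x v) + det τ (rows y v)
    first-linear v = det-linear-+ τ p (ℕₚ.<-trans (ℕₚ.n<1+n p) 1+p<k)
      (λ e → reflexive (≡.trans (≡.cong-app (setRows-first p s v F) e)
                                (≡.cong₂ (λ u w → u e + w e) (≡.sym (setRows-first p x v F)) (≡.sym (setRows-first p y v F)))))
      (λ r r≢p → reflexive ∘ ≡.cong-app (setRows-irrelevant-first p s x v F r r≢p))
      (λ r r≢p → reflexive ∘ ≡.cong-app (setRows-irrelevant-first p s y v F r r≢p))

    second-linear : ∀ u → det τ (rows u s) ≈ det τ (rows u x) + det τ (rows u y)
    second-linear u = det-linear-+ τ (ℕ.suc p) 1+p<k
      (λ e → reflexive (≡.trans (≡.cong-app (setRows-second p u s F) e)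
                                (≡.cong₂ (λ v w → v e + w e) (≡.sym (setRows-second p u x F)) (≡.sym (setRows-second p u y F)))))
      (λ r r≢1+p → reflexive ∘ ≡.cong-app (setRows-irrelevant-second p u s x F r r≢1+p))
      (λ r r≢1+p → reflexive ∘ ≡.cong-app (setRows-irrelevant-second p u s y F r r≢1+p))

  det-alternating< : ∀ {k} (τ : Vec (Fin n) k) (F : ℕ → Row) i j → i < j → j < k → F i ≈ʳ F j → det τ F ≈ 0#
  det-alternating< τ F i ℕ.zero    () _ _
  det-alternating< τ F i (ℕ.suc j) i<1+j 1+j<k Fᵢ≈Fⱼ with i ℕ.≟ j
  ... | yes ≡.refl = det-adjacent τ F i 1+j<k Fᵢ≈Fⱼ
  ... | no  i≢j    = begin
    det τ F                 ≈⟨ -‿involutive _ ⟨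
    - - det τ F             ≈⟨ -‿cong (det-swap τ F j 1+j<k) ⟨
    - det τ swapped         ≈⟨ -‿cong swapped≈0 ⟩
    - 0#                    ≈⟨ -0#≈0# ⟩
    0#                      ∎
    where
    swapped : ℕ → Row
    swapped = setRows j (F (ℕ.suc j)) (F j) F

    i<j : i < j
    i<j = ℕₚ.≤∧≢⇒< (ℕₚ.≤-pred i<1+j) i≢j

    swapped≈0 : det τ swapped ≈ 0#
    swapped≈0 = det-alternating< τ swapped i j i<j (ℕₚ.<-trans (ℕₚ.n<1+n j) 1+j<k)
      (λ e → trans (reflexive (≡.cong-app (setRows-other j _ _ F i i≢j (ℕₚ.<⇒≢ i<1+j)) e))
                   (trans (Fᵢ≈Fⱼ e) (reflexive (≡.cong-app (≡.sym (setRows-first j (F (ℕ.suc j)) (F j) F)) e))))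

  det-alternating : ∀ {k} (τ : Vec (Fin n) k) (F : ℕ → Row) i j → i ≢ j → i < k → j < k → F i ≈ʳ F j → det τ F ≈ 0#
  det-alternating τ F i j i≢j i<k j<k Fᵢ≈Fⱼ with ℕₚ.<-cmp i j
  ... | tri< i<j _ _ = det-alternating< τ F i j i<j j<k Fᵢ≈Fⱼ
  ... | tri≈ _ i≡j _ = ⊥-elim (i≢j i≡j)
  ... | tri> _ _ j<i = det-alternating< τ F j i j<i i<k (λ e → sym (Fᵢ≈Fⱼ e))

  0ʳ : Row
  0ʳ _ = 0#

  lookupℕ-< : ∀ {a} {A : Set a} {k} default (v : Vec A k) l (l<k : l < k) → lookupℕ default v l ≡ lookup v (Fin.fromℕ< l<k)
  lookupℕ-< default (x ∷ v) ℕ.zero    l<k       = ≡.refl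
  lookupℕ-< default (x ∷ v) (ℕ.suc l) (s≤s l<k) = lookupℕ-< default v l l<k

  unitRows : ∀ {k} → Vec (Fin n) k → ℕ → Row
  unitRows τ = lookupℕ 0ʳ (Vec.map unit τ)

  det-unitRows : ∀ {k} (τ : Vec (Fin n) k) → (∀ a b → lookup τ a ≡ lookup τ b → a ≡ b) → det τ (unitRows τ) ≈ 1#
  det-unitRows []                injective = refl
  det-unitRows {ℕ.suc k} (t ∷ τ) injective = begin
    det (t ∷ τ) (unitRows (t ∷ τ))                       ≈⟨ Σℕ-first k {expansion} later-rows ⟩
    1# * (unit t t * det τ (minor (unitRows (t ∷ τ)) 0)) ≈⟨ *-identityˡ _ ⟩
    unit t t * det τ (minor (unitRows (t ∷ τ)) 0)        ≈⟨ *-cong (unit-same t) (det-cong τ first-minor) ⟩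
    1# * det τ (unitRows τ)                              ≈⟨ *-identityˡ _ ⟩
    det τ (unitRows τ)                                   ≈⟨ det-unitRows τ (λ a b eq → Finₚ.suc-injective (injective (suc a) (suc b) eq)) ⟩
    1#                                                   ∎
    where
    expansion : ℕ → Carrier
    expansion l = signPow R l * (unitRows (t ∷ τ) l t * det τ (minor (unitRows (t ∷ τ)) l))

    first-minor : ∀ r → minor (unitRows (t ∷ τ)) 0 r ≈ʳ unitRows τ r
    first-minor r e = reflexive (≡.cong (λ z → unitRows (t ∷ τ) z e) (punchInℕ-≮ {0} {r} (λ ())))

    later-rows : ∀ l → l < k → expansion (ℕ.suc l) ≈ 0#
    later-rows l l<k = trans (*-congˡ (trans (*-congʳ (reflexive (≡.cong-app (≡.trans (lookupℕ-< 0ʳ (Vec.map unit τ) l l<k)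
                                                                                     (Vecₚ.lookup-map (Fin.fromℕ< l<k) unit τ)) t)))
                                             (trans (*-congʳ (unit-other t≢τₗ)) (zeroˡ _))))
                             (zeroʳ _)
      where
      t≢τₗ : t ≢ lookup τ (Fin.fromℕ< l<k)
      t≢τₗ eq = Finₚ.0≢1+n (injective zero (suc (Fin.fromℕ< l<k)) eq)

module Cohomology {c ℓ : Level} (R : CommutativeRing c ℓ) {n m : ℕ} (ρ̄ : Fin n → Fin m → CommutativeRing.Carrier R)
                  (independent : LinearlyIndependent R ρ̄) where
  open RingFacts R
  open ExteriorCalculus R ρ̄
  open BasisWedges R ρ̄
  open KoszulHomotopy R ρ̄ independent
  open Determinant R n using (det; det-cong; det-linear-+; det-linear-·; det-alternating; det-unitRows)

  H : ∀ {j} → C j → C j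
  H = Hᴸ (List.allFin n)

  δH≈id-Pᴬˡˡ : ∀ {i j} (x : C j) → IsCocycle R ρ̄ i x → ∀ S → ∣ S ∣ₛ ≡ i → δ (H x) S ≈ᵂ[ S ] x S ++ negate (Pᴬˡˡ (x S))
  δH≈id-Pᴬˡˡ {i} x cocycle S ∣S∣≡i =
    rel-sym (++-identityʳ _) ▸ ++-congˡ _ (rel-sym Hδx≈[]) ▸ homotopy-identity (List.allFin n) x S
    where
    Hδx≈[] : H (δ x) S ≈ᵂ[ S ] []
    Hδx≈[] = Hᴸ-cong (List.allFin n) {δ x} {λ _ → []} {i} cocycle S ∣S∣≡i ▸ Hᴸ-[] (List.allFin n) S

  H⁰-vanishes : ∀ j → j ≢ n → HVanishes R ρ̄ 0 j
  H⁰-vanishes j j≢n x cocycle S ∣S∣≡0 =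
    rel-sym (++-identityʳ (x S)) ▸ ++-congˡ (x S) (rel-sym (rel-· (- 1#) (Pᴬˡˡ-vanish j≢n (x S))))
    ▸ rel-sym (δH≈id-Pᴬˡˡ x cocycle S ∣S∣≡0) ▸ δ-empty (H x) S (∣S∣≡0⇒lookup≡false S ∣S∣≡0)

  H⁺-vanishes : ∀ i j → HVanishes R ρ̄ (ℕ.suc i) j
  H⁺-vanishes i j x cocycle = H x , λ S ∣S∣≡1+i →
    δH≈id-Pᴬˡˡ x cocycle S ∣S∣≡1+i ▸ ++-congˡ (x S) (rel-· (- 1#) (Pᴬˡˡ≈[] S ∣S∣≡1+i)) ▸ ++-identityʳ (x S)
    where
    Pᴬˡˡ≈[] : ∀ S → ∣ S ∣ₛ ≡ ℕ.suc i → Pᴬˡˡ (x S) ≈ᵂ[ S ] []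
    Pᴬˡˡ≈[] S ∣S∣≡1+i with ∣S∣≡suc⇒nonempty S ∣S∣≡1+i
    ... | e , e∈S = Pᴸ-vanish (∈-allFin e) e∈S (x S)

  rows : Vec Nᶜ n → ℕ → Nᶜ
  rows = lookupℕ 0ᴺ

  det⋀ : Vec Nᶜ n → Carrier
  det⋀ v = det (Vec.allFin n) (rows v)

  φᵂ : ⋀ n → Carrier
  φᵂ []            = 0#
  φᵂ ((a , v) ∷ w) = a * det⋀ v + φᵂ w

  φᵂ-++ : ∀ (x y : ⋀ n) → φᵂ (x ++ y) ≈ φᵂ x + φᵂ y
  φᵂ-++ []            y = sym (+-identityˡ _)
  φᵂ-++ ((a , v) ∷ x) y = trans (+-congˡ (φᵂ-++ x y)) (sym (+-assoc _ _ _))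

  φᵂ-scale : ∀ a (w : ⋀ n) → φᵂ (scale a w) ≈ a * φᵂ w
  φᵂ-scale a []            = sym (zeroʳ a)
  φᵂ-scale a ((b , v) ∷ w) = trans (+-cong (*-assoc a b _) (φᵂ-scale a w)) (sym (distribˡ a _ _))

  rows-update : ∀ (v : Vec Nᶜ n) i x r → r ≢ toℕ i → rows (v [ i ]≔ x) r ≡ rows v r
  rows-update v i x r r≢i = lookupℕ-update′ 0ᴺ v i x r r≢i

  rows-update-same : ∀ (v : Vec Nᶜ n) i x → rows (v [ i ]≔ x) (toℕ i) ≡ x
  rows-update-same v i x = lookupℕ-update 0ᴺ v i x

  rows-update-cong : ∀ (v : Vec Nᶜ n) i x y → x ≈ᴺ y → ∀ r → rows (v [ i ]≔ x) r ≈ᴺ rows (v [ i ]≔ y) r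
  rows-update-cong v i x y x≈y r e with r ℕ.≟ toℕ i
  ... | yes ≡.refl = trans (reflexive (≡.cong-app (rows-update-same v i x) e))
                           (trans (x≈y e) (reflexive (≡.cong-app (≡.sym (rows-update-same v i y)) e)))
  ... | no  r≢i    = reflexive (≡.cong-app (≡.trans (rows-update v i x r r≢i) (≡.sym (rows-update v i y r r≢i))) e)

  rows-update-other : ∀ (v : Vec Nᶜ n) i x y r → r ≢ toℕ i → rows (v [ i ]≔ x) r ≈ᴺ rows (v [ i ]≔ y) r
  rows-update-other v i x y r r≢i e = reflexive (≡.cong-app (≡.trans (rows-update v i x r r≢i) (≡.sym (rows-update v i y r r≢i))) e)

  det⋀-linear-+ : ∀ (v : Vec Nᶜ n) i x y → det⋀ (v [ i ]≔ (x +ₙ y)) ≈ det⋀ (v [ i ]≔ x) + det⋀ (v [ i ]≔ y)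
  det⋀-linear-+ v i x y = det-linear-+ (Vec.allFin n) (toℕ i) (Finₚ.toℕ<n i)
    (λ e → trans (reflexive (≡.cong-app (rows-update-same v i _) e))
                 (sym (+-cong (reflexive (≡.cong-app (rows-update-same v i x) e)) (reflexive (≡.cong-app (rows-update-same v i y) e)))))
    (λ r r≢i → rows-update-other v i _ x r r≢i) (λ r r≢i → rows-update-other v i _ y r r≢i)

  det⋀-linear-· : ∀ (v : Vec Nᶜ n) i b x → det⋀ (v [ i ]≔ (b ·ₙ x)) ≈ b * det⋀ (v [ i ]≔ x)
  det⋀-linear-· v i b x = det-linear-· (Vec.allFin n) (toℕ i) b (Finₚ.toℕ<n i)
    (λ e → trans (reflexive (≡.cong-app (rows-update-same v i _) e)) (*-congˡ (sym (reflexive (≡.cong-app (rows-update-same v i x) e)))))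
    (λ r r≢i → rows-update-other v i _ x r r≢i)

  det⋀-alternating : ∀ (v : Vec Nᶜ n) i k x → i ≢ k → det⋀ ((v [ i ]≔ x) [ k ]≔ x) ≈ 0#
  det⋀-alternating v i k x i≢k =
    det-alternating (Vec.allFin n) _ (toℕ i) (toℕ k) (i≢k ∘ Finₚ.toℕ-injective) (Finₚ.toℕ<n i) (Finₚ.toℕ<n k) λ e →
      reflexive (≡.cong-app (≡.trans (rows-update (v [ i ]≔ x) k x (toℕ i) (i≢k ∘ Finₚ.toℕ-injective))
                                     (≡.trans (rows-update-same v i x) (≡.sym (rows-update-same (v [ i ]≔ x) k x)))) e)

  φᵂ-cong : ∀ {w w′ : ⋀ n} → w ≈ᵂ[ ⊥ ] w′ → φᵂ w ≈ φᵂ w′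
  φᵂ-cong rel-refl                      = refl
  φᵂ-cong (rel-sym w≈w′)                = sym (φᵂ-cong w≈w′)
  φᵂ-cong (rel-trans w≈w′ w′≈w″)        = trans (φᵂ-cong w≈w′) (φᵂ-cong w′≈w″)
  φᵂ-cong (rel-++ {x} {x′} {y} {y′} x≈x′ y≈y′) =
    trans (φᵂ-++ x y) (trans (+-cong (φᵂ-cong x≈x′) (φᵂ-cong y≈y′)) (sym (φᵂ-++ x′ y′)))
  φᵂ-cong (rel-· a {x} {y} x≈y)         = trans (φᵂ-scale a x) (trans (*-congˡ (φᵂ-cong x≈y)) (sym (φᵂ-scale a y)))
  φᵂ-cong (rel-comm x y)                = trans (φᵂ-++ x y) (trans (+-comm _ _) (sym (φᵂ-++ y x)))
  φᵂ-cong (rel-zero v)                  = trans (+-identityʳ _) (zeroˡ _)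
  φᵂ-cong (rel-coef v a≈b)              = +-congʳ (*-congʳ a≈b)
  φᵂ-cong (rel-add a b v)               = trans (sym (+-assoc _ _ _)) (+-congʳ (sym (distribʳ _ a b)))
  φᵂ-cong (rel-entry a v i x y x≈y)     =
    +-congʳ (*-congˡ (det-cong (Vec.allFin n) (rows-update-cong v i x y λ e →
      ≈ᴺ[S]⇒agreeOff independent x≈y e (Vecₚ.lookup-replicate e false))))
  φᵂ-cong (rel-lin+ a v i x y)          = trans (+-congʳ (trans (*-congˡ (det⋀-linear-+ v i x y)) (distribˡ a _ _))) (+-assoc _ _ _)
  φᵂ-cong (rel-lin· a v i b x)          = +-congʳ (trans (*-congˡ (det⋀-linear-· v i b x)) (sym (*-assoc a b _)))
  φᵂ-cong (rel-alt a v i k x i≢k)       = trans (+-congʳ (trans (*-congˡ (det⋀-alternating v i k x i≢k)) (zeroʳ a))) (+-identityˡ _)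

  det⋀-standardWedge : det⋀ standardWedge ≈ 1#
  det⋀-standardWedge = det-unitRows (Vec.allFin n) (λ a b eq → ≡.trans (≡.sym (Vecₚ.lookup-allFin a)) (≡.trans eq (Vecₚ.lookup-allFin b)))

  standardWedge-vanish : ∀ S f → lookup S f ≡ true → ∀ b → (b , standardWedge) ∷ [] ≈ᵂ[ S ] []
  standardWedge-vanish S f f∈S b =
    ≡⇒≈ᵂ (≡.cong (λ u → (b , u) ∷ []) (≡.sym (Vecₚ.[]≔-lookup standardWedge f)))
    ▸ rel-entry b standardWedge f (lookup standardWedge f) 0ᴺ (agreeOff⇒≈ᴺ[S] off-S)
    ▸ zero-entry b standardWedge f
    where
    off-S : ∀ e → ¬ (e ∈ₛ S) → lookup standardWedge f e ≈ 0ᴺ e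
    off-S e e∉S = trans (reflexive (≡.cong-app (≡.trans (lookup-map-unit (Vec.allFin n) f) (≡.cong unit (Vecₚ.lookup-allFin f))) e))
                        (unit-other (λ e≡f → e∉S (≡.subst (_∈ₛ S) (≡.sym e≡f) (lookup≡true⇒∈ f∈S))))

  ψ : Carrier → Cochain R ρ̄ n
  ψ a S = (a , standardWedge) ∷ []

  φ : Cochain R ρ̄ n → Carrier
  φ x = φᵂ (x ⊥)

  ψ-cocycle : ∀ a → IsCocycle R ρ̄ 0 (ψ a)
  ψ-cocycle a S _ = ≡⇒≈ᵂ (δ-⨁ (ψ a) S) ▸ ⨁-zero pieces
    where
    pieces : ∀ f → piece (ψ a) S f ≈ᵂ[ S ] []
    pieces f with lookup S f in f∈?S
    ... | true  = standardWedge-vanish S f f∈?S _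
    ... | false = rel-refl

  ∣S∣≡0⇒S≡⊥ : ∀ (S : Subset n) → ∣ S ∣ₛ ≡ 0 → S ≡ ⊥
  ∣S∣≡0⇒S≡⊥ S ∣S∣≡0 = Subset-ext (λ i → ≡.trans (∣S∣≡0⇒lookup≡false S ∣S∣≡0 i) (≡.sym (Vecₚ.lookup-replicate i false)))

  ψ∘φ≈id : ∀ x → ψ (φ x) ⊥ ≈ᵂ[ ⊥ ] x ⊥
  ψ∘φ≈id x with top-degree-cyclic {⊥} (x ⊥)
  ... | b , x≈b = rel-coef standardWedge (trans (φᵂ-cong x≈b) (trans (+-identityʳ _) (trans (*-congˡ det⋀-standardWedge) (*-identityʳ b))))
                  ▸ rel-sym x≈b

  H⁰≅R : H0IsoR R ρ̄ n
  H⁰≅R = ψ , φ , ψ-cocycle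
       , (λ a b S _ → rel-sym (rel-add a b standardWedge))
       , (λ a b S _ → rel-refl)
       , (λ x y _ _ x≈y → φᵂ-cong (x≈y ⊥ (∣⊥∣≡0 n)))
       , (λ a → trans (+-identityʳ _) (trans (*-congˡ det⋀-standardWedge) (*-identityʳ a)))
       , (λ x _ S ∣S∣≡0 → ≡.subst (λ T → ψ (φ x) T ≈ᵂ[ T ] x T) (≡.sym (∣S∣≡0⇒S≡⊥ S ∣S∣≡0)) (ψ∘φ≈id x))

-- The hypotheses that n ≥ 1 and that the coordinates of ρ̄ lie in {-1, 0, 1} are not needed.
proposition5p3 : ∀ {c ℓ} (R : CommutativeRing c ℓ) → IsPID R
    → (n : ℕ) → 1 ≤ n → (m : ℕ)
    → (ρ̄ : Fin n → Fin m → CommutativeRing.Carrier R)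
    → CoordsIn-101 R ρ̄ → IsQuasiRepOfUnn R ρ̄
    → H0IsoR R ρ̄ n × (∀ i j → ¬ (i ≡ 0 × j ≡ n) → HVanishes R ρ̄ i j)
proposition5p3 R pid n _ m ρ̄ _ quasiRep = H⁰≅R , vanishing
  where
  open Cohomology R ρ̄ (QuasiRepresentationIndependence.quasiRep⇒independent R pid ρ̄ quasiRep)

  vanishing : ∀ i j → ¬ (i ≡ 0 × j ≡ n) → HVanishes R ρ̄ i j
  vanishing ℕ.zero    j not-top = H⁰-vanishes j (λ j≡n → not-top (≡.refl , j≡n))
  vanishing (ℕ.suc i) j _       = H⁺-vanishes i j
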